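{- For every integer $n\ge 0$, with $r(n)=3^n-2^n$, \[ E(n)=\sum_{T\in\mathrm{RV}^+_{n;2}}\tilde h_{\mathrm{val}(T)}=\sum_{k=2^n-r(n)}^{2^n+r(n)}c_{2k}\tilde h_{2k} \] (equality in $\tilde{\mathrm{CH}}_2$), where the integers $c_{2k}$ satisfy, for $i\ge 0$: (i) $c_{2k}>0$ for $2^n-r(n)\le k\le 2^n+r(n)$; (ii) $c_{2^{n+1}-2i}=c_{2^{n+1}+2i}$; (iii) $c_{2^{n+1}-2i}\ge c_{2^{n+1}-2i-2}$. Furthermore \[ L(E(n))=\sum_{T\in\mathrm{RV}'_{n;2}}h_{\mathrm{val}(T)},\qquad \mathrm{RV}'_{n;2}=\{T\in\mathrm{RV}^+_{n;2}:\ \mathrm{val}(T)\ge\max(\mathrm{rad}(T)-2^{n+1},0)\}. \]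
   Context: $\tau(i)=|i+1|-1$. $\tilde{\mathrm{CH}}_2$: elements are finite integer linear combinations of linearly independent symbols $\tilde h_i$, $i\in\mathbb{Z}$, with bilinear multiplication $\tilde h_{ -1}\tilde h_j=0$, $\tilde h_i\tilde h_j=\sum_{k=0}^i\tilde h_{j-i+2k}$ ($i\ge0$), $\tilde h_i\tilde h_j=-\tilde h_{\tau(i)}\tilde h_j$ ($i<-1$). $\mathrm{CH}_2$: finite integer linear combinations of linearly independent symbols $h_i$, $i\ge 0$ (with $h_ih_j=\sum_{k=0}^{\min(i,j)}h_{|j-i|+2k}$). $L:\tilde{\mathrm{CH}}_2\to\mathrm{CH}_2$ is the linear map $L(\tilde h_i)=\mathrm{sgn}(i+1)h_{\tau(i)}$ (so $L(\tilde h_{ -1})=0$). $\rho(r_1,r_2,x,y)=r_1+y$ if $y\ge -x+r_2-r_1$, and $=r_2-x$ otherwise. Radius-value trees: height $0$: a single vertex labeled by an even integer (its value). Height $n+1$: $T=(l,T_1,T_2,T_3)$, $l$ even, $T_i$ of height $n$, $|l-\mathrm{val}(T_1)-\mathrm{val}(T_3)|\le\tau(\mathrm{val}(T_2))$, $\mathrm{val}(T)=l$. $\mathrm{sgn}(T)=1$ at height $0$, otherwise $\mathrm{sgn}(T)=\mathrm{sgn}(\mathrm{val}(T_2)+1)\prod_{i=1}^3\mathrm{sgn}(T_i)$. $\mathrm{RV}_{n;2}$: height-$n$ trees all of whose leaves are labeled $2$. $E(n)=\sum_{T\in\mathrm{RV}_{n;2}}\mathrm{sgn}(T)\tilde h_{\mathrm{val}(T)}$.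 For $T\in\mathrm{RV}_{n;2}$, $\mathrm{ind}(T)=\mathrm{val}(T)-2^{n+1}$. $\mathrm{rad}(T)=0$ at height $0$; $\mathrm{rad}(T_1,T_3)=\rho(\mathrm{rad}(T_1),\mathrm{rad}(T_3),\mathrm{ind}(T_1),\mathrm{ind}(T_3))$; for $T=(l,T_1,T_2,T_3)$ with $j=l-\mathrm{val}(T_1)-\mathrm{val}(T_3)$, $\mathrm{rad}(T)=\rho(\mathrm{rad}(T_1,T_3),\tau(\mathrm{val}(T_2)),\mathrm{ind}(T_1)+\mathrm{ind}(T_3),j)$. $\mathrm{RV}^+_{0;2}=\mathrm{RV}_{0;2}$; for $n\ge1$, $\mathrm{RV}^+_{n;2}$ consists of $T=(l,T_1,T_2,T_3)\in\mathrm{RV}_{n;2}$ with $T_i\in\mathrm{RV}^+_{n-1;2}$ and $\mathrm{val}(T_2)\ge\max(\mathrm{rad}(T_2)-2^n,0)$. -}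

module Defs where

open import Data.Bool using (Bool; true; false; _∧_; if_then_else_)
open import Data.Nat as ℕ using (ℕ; zero; suc; _∸_)
open import Data.Integer as ℤ using (ℤ; +_; -[1+_]; _+_; _-_; _*_; -_; ∣_∣; _≤ᵇ_; _⊔_)
open import Data.Product using (_×_; _,_)
open import Data.List using (List; []; _∷_; map; concatMap; filter; upTo; foldr)
open import Relation.Nullary.Decidable using (⌊_⌋)
open import Relation.Binary.PropositionalEquality using (_≡_)

-- An element is a finite formal sum
-- Σ c·[a], represented as a list of (coefficient , symbol) pairs;
-- two elements are equal iff all their coefficients agree.

FreeAb : Set → Set
FreeAb A = List (ℤ × A)

coeffℤ : FreeAb ℤ → ℤ → ℤ
coeffℤ [] m = + 0
coeffℤ ((c , i) ∷ xs) m = (if ⌊ i ℤ.≟ m ⌋ then c else + 0) + coeffℤ xs m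

coeffℕ : FreeAb ℕ → ℕ → ℤ
coeffℕ [] m = + 0
coeffℕ ((c , i) ∷ xs) m = (if ⌊ i ℕ.≟ m ⌋ then c else + 0) + coeffℕ xs m

-- CH̃₂ : combinations of h̃_i (i ∈ ℤ);  CH₂ : combinations of h_i (i ≥ 0)
CHt : Set
CHt = FreeAb ℤ

CH : Set
CH = FreeAb ℕ

_≈t_ : CHt → CHt → Set
x ≈t y = ∀ m → coeffℤ x m ≡ coeffℤ y m

_≈h_ : CH → CH → Set
x ≈h y = ∀ m → coeffℕ x m ≡ coeffℕ y m

τ : ℤ → ℤ
τ i = + ∣ i + + 1 ∣ - + 1

sgn : ℤ → ℤ
sgn (+ zero) = + 0
sgn (+ suc _) = + 1
sgn -[1+ _ ] = - + 1

-- L(h̃_i) = sgn(i+1) h_{τ(i)}   (for i = -1 the coefficient is 0;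
-- otherwise τ(i) = ∣i+1∣ ∸ 1 ≥ 0)
L : CHt → CH
L = map (λ { (c , i) → (c * sgn (i + + 1) , ∣ i + + 1 ∣ ∸ 1) })

ρ : ℤ → ℤ → ℤ → ℤ → ℤ
ρ r₁ r₂ x y = if (- x + r₂ - r₁) ≤ᵇ y then r₁ + y else r₂ - x

pow2 : ℕ → ℤ
pow2 n = + (2 ℕ.^ n)

data Tree : Set where
  leaf : ℤ → Tree
  node : ℤ → Tree → Tree → Tree → Tree

val : Tree → ℤ
val (leaf l) = l
val (node l _ _ _) = l

sgnT : Tree → ℤ
sgnT (leaf _) = + 1
sgnT (node _ t₁ t₂ t₃) = sgn (val t₂ + + 1) * (sgnT t₁ * sgnT t₂ * sgnT t₃)

ind : ℕ → Tree → ℤ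
ind n t = val t - pow2 (suc n)

rad : ℕ → Tree → ℤ
rad zero _ = + 0
rad (suc m) (leaf _) = + 0   -- ill-formed case, never used
rad (suc m) (node l t₁ t₂ t₃) =
  ρ (ρ (rad m t₁) (rad m t₃) (ind m t₁) (ind m t₃))
    (τ (val t₂))
    (ind m t₁ + ind m t₃)
    (l - val t₁ - val t₃)

isEven : ℤ → Bool
isEven i = ∣ i ∣ ℕ.% 2 ℕ.≡ᵇ 0

interval : ℤ → ℤ → List ℤ
interval a b = if a ≤ᵇ b then map (λ j → a + + j) (upTo (suc ∣ b - a ∣)) else []

-- Enumeration (without repetition) of RV_{n;2}: height-n trees all of
-- whose leaves are labelled 2.  A height-(n+1) tree is (l,T₁,T₂,T₃) with
-- Tᵢ ∈ RV_{n;2}, l even and |l - val T₁ - val T₃| ≤ τ(val T₂).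
RV : ℕ → List Tree
RV zero = leaf (+ 2) ∷ []
RV (suc n) =
  concatMap (λ t₁ → concatMap (λ t₂ → concatMap (λ t₃ →
     map (λ l → node l t₁ t₂ t₃)
         (filter (λ l → Data.Bool.T? (isEven l))
            (interval (val t₁ + val t₃ - τ (val t₂)) (val t₁ + val t₃ + τ (val t₂)))))
    (RV n)) (RV n)) (RV n)
  where import Data.Bool

plus : ℕ → Tree → Bool
plus zero _ = true
plus (suc m) (leaf _) = false
plus (suc m) (node l t₁ t₂ t₃) =
  plus m t₁ ∧ plus m t₂ ∧ plus m t₃ ∧ (((rad m t₂ - pow2 (suc m)) ⊔ + 0) ≤ᵇ val t₂)

RV⁺ : ℕ → List Tree
RV⁺ n = filter (λ t → Data.Bool.T? (plus n t)) (RV n)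
  where import Data.Bool

RV' : ℕ → List Tree
RV' n = filter (λ t → Data.Bool.T? (((rad n t - pow2 (suc n)) ⊔ + 0) ≤ᵇ val t)) (RV⁺ n)
  where import Data.Bool

E : ℕ → CHt
E n = map (λ t → (sgnT t , val t)) (RV n)

sumPlus : ℕ → CHt
sumPlus n = map (λ t → (+ 1 , val t)) (RV⁺ n)

-- Σ_{T ∈ RV'_{n;2}} h_{val T}   (val T ≥ 0 here, so index ∣val T∣)
sumPrime : ℕ → CH
sumPrime n = map (λ t → (+ 1 , ∣ val t ∣)) (RV' n)

r : ℕ → ℕ
r n = 3 ℕ.^ n ∸ 2 ℕ.^ n

rangeSum : ℕ → (ℤ → ℤ) → CHt
rangeSum n c = map (λ k → (c (+ 2 * k) , + 2 * k))
                   (interval (pow2 n - + r n) (pow2 n + + r n))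

-- Write ind T = val T − 2ⁿ⁺¹ and read the pairs (ind T, rad T), T ∈ RV⁺ₙ, as weights of
-- sl₂-modules: the string of radius r is {(2k − r, r) : 0 ≤ k ≤ r}, the weights of the
-- irreducible module V_r.  The function ρ is the Clebsch–Gordan rule
-- V_p ⊗ V_q = V_{p+q} ⊕ V_{p+q−2} ⊕ … ⊕ V_{|p−q|}, and the trees (l, T₁, T₂, T₃) of height
-- n + 1 with given children contribute T₁ ⊗ T₃ ⊗ V_{val T₂}.  So by induction the pairs of RV⁺ₙ
-- form a union of strings, of radius at most, and of the parity of, 2(3ⁿ − 2ⁿ), that radius
-- occurring.  L reflects h̃ᵢ across i = −1 with a sign change; on a string centred at 2ⁿ⁺¹ the
-- reflected part cancels and the surviving weights are exactly those satisfying the RV′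
-- condition.  This gives L(E(n)), and since the sign sgn(val T₂ + 1) of a node is L applied to
-- its middle subtree, it also gives E(n) = ∑_{RV⁺} h̃_{val T} by induction.  The coefficients of
-- E(n) are therefore sums of string multiplicities centred at 2ⁿ⁺¹: symmetric, unimodal, and
-- positive on the range of the longest string.

module Submission where

open import Data.Bool using (Bool; true; false; T; T?; if_then_else_; _∧_)
open import Data.Bool.Properties using (if-∧; if-swap-then)
open import Data.Empty using (⊥-elim)
open import Data.Integer as ℤ
  using (ℤ; +_; +[1+_]; -[1+_]; _+_; _-_; _*_; -_; _≤_; _<_; _≥_; _≤ᵇ_; _⊔_; ∣_∣; +≤+; +<+)
import Data.Integer.Properties as ℤₚ
open import Algebra.Properties.CommutativeSemigroup ℤₚ.+-commutativeSemigroup using (interchange)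
open import Data.Integer.Tactic.RingSolver using (solve-∀)
open import Data.List using (List; []; _∷_; _++_; map; concatMap; filter; upTo; applyUpTo)
open import Data.List.Properties using (map-∘)
open import Data.List.Membership.Propositional using (_∈_; lose)
open import Data.List.Membership.Propositional.Properties using (∈-upTo⁺; ∈-concatMap⁺)
open import Data.List.Relation.Unary.All as All using (All; []; _∷_)
import Data.List.Relation.Unary.All.Properties as All
open import Data.List.Relation.Unary.Any using (here; there)
open import Data.Nat as ℕ using (ℕ; zero; suc; _∸_; _^_; z≤n; s≤s)
open import Data.Nat.DivMod using (m≡m%n+[m/n]*n)
import Data.Nat.Properties as ℕₚ
import Data.Nat.Tactic.RingSolver as ℕ-Solver
open import Data.Product using (Σ; ∃-syntax; _×_; _,_)
open import Function using (_∘_)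
open import Relation.Binary.Definitions using (tri<; tri≈; tri>)
open import Relation.Binary.PropositionalEquality hiding ([_])
open import Relation.Nullary using (¬_; yes; no)
open import Relation.Nullary.Decidable using (⌊_⌋)

open import Defs

infix 5 ∑ ∑<

infixr 5 [_]_

[_]_ : Bool → ℤ → ℤ
[ b ] x = if b then x else + 0

∑ : {A : Set} → (A → ℤ) → List A → ℤ
∑ f []       = + 0
∑ f (x ∷ xs) = f x + ∑ f xs

syntax ∑ (λ x → e) xs = ∑[ x ∈ xs ] e

∑< : ℕ → (ℕ → ℤ) → ℤ
∑< zero    f = + 0
∑< (suc n) f = f 0 + ∑< n (f ∘ suc)

syntax ∑< n (λ k → e) = ∑[ k < n ] e

module _ {A : Set} where

  ∑-cong : {f g : A → ℤ} (xs : List A) → (∀ x → f x ≡ g x) → ∑ f xs ≡ ∑ g xs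
  ∑-cong []       f≗g = refl
  ∑-cong (x ∷ xs) f≗g = cong₂ _+_ (f≗g x) (∑-cong xs f≗g)

  ∑-cong-All : {P : A → Set} {f g : A → ℤ} {xs : List A} →
               All P xs → (∀ {x} → P x → f x ≡ g x) → ∑ f xs ≡ ∑ g xs
  ∑-cong-All []       f≗g = refl
  ∑-cong-All (p ∷ ps) f≗g = cong₂ _+_ (f≗g p) (∑-cong-All ps f≗g)

  ∑-++ : (f : A → ℤ) (xs ys : List A) → ∑ f (xs ++ ys) ≡ ∑ f xs + ∑ f ys
  ∑-++ f []       ys = sym (ℤₚ.+-identityˡ _)
  ∑-++ f (x ∷ xs) ys = trans (cong (_+_ (f x)) (∑-++ f xs ys)) (sym (ℤₚ.+-assoc (f x) _ _))

  ∑-zero : (xs : List A) → ∑[ x ∈ xs ] + 0 ≡ + 0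
  ∑-zero []       = refl
  ∑-zero (x ∷ xs) = trans (ℤₚ.+-identityˡ _) (∑-zero xs)

  ∑-distrib-+ : (f g : A → ℤ) (xs : List A) → ∑[ x ∈ xs ] (f x + g x) ≡ ∑ f xs + ∑ g xs
  ∑-distrib-+ f g []       = refl
  ∑-distrib-+ f g (x ∷ xs) =
    trans (cong (_+_ (f x + g x)) (∑-distrib-+ f g xs)) (interchange (f x) (g x) _ _)

  ∑-*ˡ : (c : ℤ) (f : A → ℤ) (xs : List A) → ∑[ x ∈ xs ] c * f x ≡ c * ∑ f xs
  ∑-*ˡ c f []       = sym (ℤₚ.*-zeroʳ c)
  ∑-*ˡ c f (x ∷ xs) = trans (cong (_+_ (c * f x)) (∑-*ˡ c f xs)) (sym (ℤₚ.*-distribˡ-+ c (f x) _))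

  ∑-indicator : (b : Bool) (f : A → ℤ) (xs : List A) → ∑[ x ∈ xs ] [ b ] f x ≡ [ b ] ∑ f xs
  ∑-indicator true  f xs = refl
  ∑-indicator false f xs = ∑-zero xs

  ∑-filter : (p : A → Bool) (f : A → ℤ) (xs : List A) →
             ∑ f (filter (T? ∘ p) xs) ≡ ∑[ x ∈ xs ] [ p x ] f x
  ∑-filter p f []       = refl
  ∑-filter p f (x ∷ xs) with p x
  ... | true  = cong (_+_ (f x)) (∑-filter p f xs)
  ... | false = trans (∑-filter p f xs) (sym (ℤₚ.+-identityˡ _))

  ∑-nonneg : (f : A → ℤ) (xs : List A) → (∀ x → + 0 ≤ f x) → + 0 ≤ ∑ f xs
  ∑-nonneg f []       0≤f = +≤+ z≤n
  ∑-nonneg f (x ∷ xs) 0≤f = ℤₚ.+-mono-≤ (0≤f x) (∑-nonneg f xs 0≤f)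

  ∑-term : (f : A → ℤ) (xs : List A) → (∀ x → + 0 ≤ f x) → ∀ {y} → y ∈ xs → f y ≤ ∑ f xs
  ∑-term f (x ∷ xs) 0≤f (here refl) = ℤₚ.i≤i+j (f x) (∑ f xs) {{ℤ.nonNegative (∑-nonneg f xs 0≤f)}}
  ∑-term f (x ∷ xs) 0≤f (there y∈xs) =
    ℤₚ.≤-trans (∑-term f xs 0≤f y∈xs) (ℤₚ.i≤j+i (∑ f xs) (f x) {{ℤ.nonNegative (0≤f x)}})

  ∑-mono-≤ : {f g : A → ℤ} (xs : List A) → (∀ x → f x ≤ g x) → ∑ f xs ≤ ∑ g xs
  ∑-mono-≤ []       f≤g = ℤₚ.≤-refl
  ∑-mono-≤ (x ∷ xs) f≤g = ℤₚ.+-mono-≤ (f≤g x) (∑-mono-≤ xs f≤g)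

module _ {A B : Set} where

  ∑-map : (f : B → ℤ) (g : A → B) (xs : List A) → ∑ f (map g xs) ≡ ∑[ x ∈ xs ] f (g x)
  ∑-map f g []       = refl
  ∑-map f g (x ∷ xs) = cong (_+_ (f (g x))) (∑-map f g xs)

  ∑-concatMap : (f : B → ℤ) (g : A → List B) (xs : List A) →
                ∑ f (concatMap g xs) ≡ ∑[ x ∈ xs ] ∑ f (g x)
  ∑-concatMap f g []       = refl
  ∑-concatMap f g (x ∷ xs) =
    trans (∑-++ f (g x) (concatMap g xs)) (cong (_+_ (∑ f (g x))) (∑-concatMap f g xs))

  ∑-comm : (f : A → B → ℤ) (xs : List A) (ys : List B) →
           ∑[ x ∈ xs ] ∑[ y ∈ ys ] f x y ≡ ∑[ y ∈ ys ] ∑[ x ∈ xs ] f x y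
  ∑-comm f []       ys = sym (∑-zero ys)
  ∑-comm f (x ∷ xs) ys =
    trans (cong (_+_ (∑ (f x) ys)) (∑-comm f xs ys)) (sym (∑-distrib-+ (f x) _ ys))

∑<-cong : (n : ℕ) {f g : ℕ → ℤ} → (∀ k → k ℕ.< n → f k ≡ g k) → ∑< n f ≡ ∑< n g
∑<-cong zero    f≗g = refl
∑<-cong (suc n) f≗g = cong₂ _+_ (f≗g 0 (s≤s z≤n)) (∑<-cong n (λ k k<n → f≗g (suc k) (s≤s k<n)))

∑<-zero : (n : ℕ) → ∑[ k < n ] + 0 ≡ + 0
∑<-zero zero    = refl
∑<-zero (suc n) = trans (ℤₚ.+-identityˡ _) (∑<-zero n)

∑<-distrib-+ : (n : ℕ) (f g : ℕ → ℤ) → ∑[ k < n ] (f k + g k) ≡ ∑< n f + ∑< n g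
∑<-distrib-+ zero    f g = refl
∑<-distrib-+ (suc n) f g =
  trans (cong (_+_ (f 0 + g 0)) (∑<-distrib-+ n (f ∘ suc) (g ∘ suc))) (interchange (f 0) (g 0) _ _)

∑<-neg : (n : ℕ) (f : ℕ → ℤ) → ∑[ k < n ] - f k ≡ - ∑< n f
∑<-neg zero    f = refl
∑<-neg (suc n) f = trans (cong (_+_ (- f 0)) (∑<-neg n (f ∘ suc))) (sym (ℤₚ.neg-distrib-+ (f 0) _))

∑<-split : (a b : ℕ) (f : ℕ → ℤ) → ∑< (a ℕ.+ b) f ≡ ∑< a f + (∑[ k < b ] f (a ℕ.+ k))
∑<-split zero    b f = sym (ℤₚ.+-identityˡ _)
∑<-split (suc a) b f = trans (cong (_+_ (f 0)) (∑<-split a b (f ∘ suc))) (sym (ℤₚ.+-assoc (f 0) _ _))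

∑<-last : (n : ℕ) (f : ℕ → ℤ) → ∑< (suc n) f ≡ ∑< n f + f n
∑<-last n f = trans (cong (λ m → ∑< m f) (ℕₚ.+-comm 1 n))
                    (trans (∑<-split n 1 f) (cong (_+_ (∑< n f)) (trans (ℤₚ.+-identityʳ _) (cong f (ℕₚ.+-identityʳ n)))))

∑<-reverse : (n : ℕ) (f : ℕ → ℤ) → ∑< n f ≡ ∑[ k < n ] f (n ∸ suc k)
∑<-reverse zero    f = refl
∑<-reverse (suc n) f = begin
    f 0 + ∑< n (f ∘ suc)
  ≡⟨ cong (_+_ (f 0)) (∑<-reverse n (f ∘ suc)) ⟩
    f 0 + (∑[ k < n ] f (suc (n ∸ suc k)))
  ≡⟨ ℤₚ.+-comm (f 0) _ ⟩
    (∑[ k < n ] f (suc (n ∸ suc k))) + f 0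
  ≡⟨ cong₂ _+_ (∑<-cong n (λ k k<n → cong f (sym (ℕₚ.+-∸-assoc 1 k<n))))
               (cong f (sym (ℕₚ.n∸n≡0 n))) ⟩
    (∑[ k < n ] f (suc n ∸ suc k)) + f (suc n ∸ suc n)
  ≡⟨ sym (∑<-last n (λ k → f (suc n ∸ suc k))) ⟩
    ∑[ k < suc n ] f (suc n ∸ suc k) ∎
  where open ≡-Reasoning

i≡-i⇒i≡0 : (i : ℤ) → i ≡ - i → i ≡ + 0
i≡-i⇒i≡0 (+ zero)  _ = refl
i≡-i⇒i≡0 (+[1+ n ]) ()
i≡-i⇒i≡0 -[1+ n ]  ()

∑<-antisymmetric : (n : ℕ) (f : ℕ → ℤ) → (∀ k → k ℕ.< n → f (n ∸ suc k) ≡ - f k) → ∑< n f ≡ + 0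
∑<-antisymmetric n f f-anti = i≡-i⇒i≡0 (∑< n f)
  (trans (∑<-reverse n f) (trans (∑<-cong n f-anti) (∑<-neg n f)))

∑<-∑ : {A : Set} (n : ℕ) (f : ℕ → A → ℤ) (xs : List A) →
       ∑[ k < n ] ∑[ x ∈ xs ] f k x ≡ ∑[ x ∈ xs ] ∑[ k < n ] f k x
∑<-∑ zero    f xs = sym (∑-zero xs)
∑<-∑ (suc n) f xs =
  trans (cong (_+_ (∑ (f 0) xs)) (∑<-∑ n (f ∘ suc) xs)) (sym (∑-distrib-+ (f 0) _ xs))

∑-applyUpTo : (f : ℕ → ℤ) (g : ℕ → ℕ) (n : ℕ) → ∑ f (applyUpTo g n) ≡ ∑[ k < n ] f (g k)
∑-applyUpTo f g zero    = refl
∑-applyUpTo f g (suc n) = cong (_+_ (f (g 0))) (∑-applyUpTo f (g ∘ suc) n)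

∑<-nonneg : (n : ℕ) (f : ℕ → ℤ) → (∀ k → + 0 ≤ f k) → + 0 ≤ ∑< n f
∑<-nonneg n f 0≤f = subst (+ 0 ≤_) (∑-applyUpTo f (λ k → k) n) (∑-nonneg f (upTo n) 0≤f)

∑<-term : (n : ℕ) (f : ℕ → ℤ) → (∀ k → + 0 ≤ f k) → ∀ {j} → j ℕ.< n → f j ≤ ∑< n f
∑<-term n f 0≤f j<n =
  subst (f _ ≤_) (∑-applyUpTo f (λ k → k) n) (∑-term f (upTo n) 0≤f (∈-upTo⁺ j<n))

∑<-single : (n : ℕ) (f : ℕ → ℤ) {j : ℕ} → j ℕ.< n → (∀ k → k ℕ.< n → k ≢ j → f k ≡ + 0) → ∑< n f ≡ f j
∑<-single (suc n) f {zero}  _         others =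
  trans (cong (_+_ (f 0)) (trans (∑<-cong n (λ k k<n → others (suc k) (s≤s k<n) (λ ()))) (∑<-zero n)))
        (ℤₚ.+-identityʳ (f 0))
∑<-single (suc n) f {suc j} (s≤s j<n) others =
  trans (cong₂ _+_ (others 0 (s≤s z≤n) (λ ()))
                   (∑<-single n (f ∘ suc) j<n (λ k k<n k≢j → others (suc k) (s≤s k<n) (k≢j ∘ ℕₚ.suc-injective))))
        (ℤₚ.+-identityˡ _)

All-concatMap⁺ : {A B : Set} {P : B → Set} {f : A → List B} {xs : List A} →
                 All (λ x → All P (f x)) xs → All P (concatMap f xs)
All-concatMap⁺ = All.concat⁺ ∘ All.map⁺

≤-by : (a b : ℤ) (e : ℕ) → b ≡ a + + e → a ≤ b
≤-by a b e b≡a+e = subst (a ≤_) (sym b≡a+e) (ℤₚ.i≤i+j a (+ e))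

<-by : (a b : ℤ) (e : ℕ) → b ≡ a + + suc e → a < b
<-by a b e b≡a+1+e = ℤₚ.<-≤-trans (lemma a) (≤-by (a + + 1) b e (trans b≡a+1+e (sym (ℤₚ.+-assoc a (+ 1) (+ e)))))
  where lemma : ∀ a → a < a + + 1
        lemma a = subst (_< a + + 1) (ℤₚ.+-identityʳ a) (ℤₚ.+-monoʳ-< a (+<+ (s≤s z≤n)))

if-true : {A : Set} {b : Bool} {x y : A} → T b → (if b then x else y) ≡ x
if-true {b = true} _ = refl

if-false : {A : Set} {b : Bool} {x y : A} → ¬ T b → (if b then x else y) ≡ y
if-false {b = false} _  = refl
if-false {b = true}  ¬t = ⊥-elim (¬t _)

if-≟-≡ : ∀ {a b x y : ℤ} → a ≡ b → (if ⌊ a ℤ.≟ b ⌋ then x else y) ≡ x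
if-≟-≡ {a} {b} a≡b with a ℤ.≟ b
... | yes _   = refl
... | no a≢b  = ⊥-elim (a≢b a≡b)

if-≟-≢ : ∀ {a b x y : ℤ} → a ≢ b → (if ⌊ a ℤ.≟ b ⌋ then x else y) ≡ y
if-≟-≢ {a} {b} a≢b with a ℤ.≟ b
... | yes a≡b = ⊥-elim (a≢b a≡b)
... | no _    = refl

ρ-≥ : ∀ r₁ r₂ x y → - x + r₂ - r₁ ≤ y → ρ r₁ r₂ x y ≡ r₁ + y
ρ-≥ r₁ r₂ x y le = if-true (ℤₚ.≤⇒≤ᵇ le)

ρ-< : ∀ r₁ r₂ x y → y < - x + r₂ - r₁ → ρ r₁ r₂ x y ≡ r₂ - x
ρ-< r₁ r₂ x y lt = if-false (ℤₚ.<⇒≱ lt ∘ ℤₚ.≤ᵇ⇒≤)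

ρ-lowest : ∀ r₁ r₂ y → y ≤ r₂ → ρ r₁ r₂ (- r₁) y ≡ r₁ + r₂
ρ-lowest r₁ r₂ y y≤r₂ with (- - r₁ + r₂ - r₁) ℤ.≤? y
... | yes le = trans (ρ-≥ r₁ r₂ (- r₁) y le)
                     (cong (_+_ r₁) (ℤₚ.≤-antisym y≤r₂ (subst (_≤ y) (threshold r₁ r₂) le)))
  where threshold : ∀ a b → - - a + b - a ≡ b
        threshold = solve-∀
... | no ≰ = trans (ρ-< r₁ r₂ (- r₁) y (ℤₚ.≰⇒> ≰))
                 (trans (cong (_+_ r₂) (ℤₚ.neg-involutive r₁)) (ℤₚ.+-comm r₂ r₁))

ρ-highest : ∀ r₁ r₂ x → - r₁ ≤ x → ρ r₁ r₂ x r₂ ≡ r₁ + r₂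
ρ-highest r₁ r₂ x -r₁≤x = ρ-≥ r₁ r₂ x r₂
  (subst (- x + r₂ - r₁ ≤_) (threshold r₁ r₂)
         (ℤₚ.+-monoˡ-≤ (- r₁) (ℤₚ.+-monoˡ-≤ r₂ (ℤₚ.neg-mono-≤ -r₁≤x))))
  where threshold : ∀ a b → - - a + b - a ≡ b
        threshold = solve-∀

ρ-shift : ∀ r₁ r₂ x y s → ρ (r₁ + s) (r₂ + s) (x + s) (y - s) ≡ ρ r₁ r₂ x y
ρ-shift r₁ r₂ x y s with (- x + r₂ - r₁) ℤ.≤? y
... | yes le = trans (ρ-≥ (r₁ + s) (r₂ + s) (x + s) (y - s)
                            (subst (_≤ y - s) (threshold r₁ r₂ x s) (ℤₚ.+-monoˡ-≤ (- s) le)))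
                     (trans (cancel r₁ y s) (sym (ρ-≥ r₁ r₂ x y le)))
  where threshold : ∀ a b x s → - x + b - a - s ≡ - (x + s) + (b + s) - (a + s)
        threshold = solve-∀
        cancel : ∀ a y s → a + s + (y - s) ≡ a + y
        cancel = solve-∀
... | no ≰ = trans (ρ-< (r₁ + s) (r₂ + s) (x + s) (y - s)
                          (subst (y - s <_) (threshold r₁ r₂ x s) (ℤₚ.+-monoˡ-< (- s) (ℤₚ.≰⇒> ≰))))
                   (trans (cancel r₂ x s) (sym (ρ-< r₁ r₂ x y (ℤₚ.≰⇒> ≰))))
  where threshold : ∀ a b x s → - x + b - a - s ≡ - (x + s) + (b + s) - (a + s)
        threshold = solve-∀
        cancel : ∀ b x s → b + s - (x + s) ≡ b - x
        cancel = solve-∀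

weight : ℕ → ℕ → ℤ
weight r k = + k + + k - + r

string : ℕ → (ℤ → ℤ → ℤ) → ℤ
string r φ = ∑[ k < suc r ] φ (weight r k) (+ r)

grid : ℕ → ℕ → (ℤ → ℤ → ℤ) → ℤ
grid p q φ = ∑[ k < suc p ] ∑[ m < suc q ]
  φ (weight p k + weight q m) (ρ (+ p) (+ q) (weight p k) (weight q m))

cgRadii : ℕ → ℕ → List ℕ
cgRadii zero    q       = q ∷ []
cgRadii (suc p) zero    = suc p ∷ []
cgRadii (suc p) (suc q) = suc p ℕ.+ suc q ∷ cgRadii p q

weight-lowest : ∀ r → weight r 0 ≡ - + r
weight-lowest r = ℤₚ.+-identityˡ (- + r)

weight-highest : ∀ r → weight r r ≡ + r
weight-highest r = lemma (+ r)
  where lemma : ∀ R → R + R - R ≡ R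
        lemma = solve-∀

weight-≥ : ∀ r k → - + r ≤ weight r k
weight-≥ r k = ≤-by (- + r) (weight r k) (k ℕ.+ k) (ℤₚ.+-comm (+ k + + k) (- + r))

weight-≤ : ∀ {r k} → k ℕ.≤ r → weight r k ≤ + r
weight-≤ {k = k} k≤r with ℕₚ.m≤n⇒∃[o]m+o≡n k≤r
... | d , refl = ≤-by _ _ (d ℕ.+ d) (lemma (+ k) (+ d))
  where lemma : ∀ K D → K + D ≡ K + K - (K + D) + (D + D)
        lemma = solve-∀

weight-+ : ∀ p q k m → weight p k + weight q m ≡ weight (p ℕ.+ q) (k ℕ.+ m)
weight-+ p q k m = lemma (+ p) (+ q) (+ k) (+ m)
  where lemma : ∀ P Q K M → K + K - P + (M + M - Q) ≡ (K + M) + (K + M) - (P + Q)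
        lemma = solve-∀

double-injective : ∀ {j j′} → j ℕ.+ j ≡ j′ ℕ.+ j′ → j ≡ j′
double-injective {j} {j′} eq with ℕₚ.<-cmp j j′
... | tri< j<j′ _ _ = ⊥-elim (ℕₚ.<-irrefl eq (ℕₚ.+-mono-< j<j′ j<j′))
... | tri≈ _ j≡j′ _ = j≡j′
... | tri> _ _ j>j′ = ⊥-elim (ℕₚ.<-irrefl (sym eq) (ℕₚ.+-mono-< j>j′ j>j′))

weight-injective : ∀ r {j j′} → weight r j ≡ weight r j′ → j ≡ j′
weight-injective r {j} {j′} eq = double-injective (ℤₚ.+-injective (begin
    + j + + j              ≡⟨ lemma (+ j) (+ r) ⟩
    weight r j + + r       ≡⟨ cong (_+ + r) eq ⟩
    weight r j′ + + r      ≡⟨ sym (lemma (+ j′) (+ r)) ⟩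
    + j′ + + j′            ∎))
  where
    open ≡-Reasoning
    lemma : ∀ J R → J + J ≡ J + J - R + R
    lemma = solve-∀

module _ (φ : ℤ → ℤ → ℤ) where

  gridPoint : ℕ → ℕ → ℕ → ℕ → ℤ
  gridPoint p q k m = φ (weight p k + weight q m) (ρ (+ p) (+ q) (weight p k) (weight q m))

  gridPoint-lowest : ∀ p q m → m ℕ.≤ q → gridPoint p q 0 m ≡ φ (weight (p ℕ.+ q) m) (+ (p ℕ.+ q))
  gridPoint-lowest p q m m≤q =
    cong₂ φ (weight-+ p q 0 m)
            (trans (cong (λ x → ρ (+ p) (+ q) x (weight q m)) (weight-lowest p))
                   (ρ-lowest (+ p) (+ q) (weight q m) (weight-≤ m≤q)))

  gridPoint-highest : ∀ p q k → gridPoint p q k q ≡ φ (weight (p ℕ.+ q) (k ℕ.+ q)) (+ (p ℕ.+ q))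
  gridPoint-highest p q k =
    cong₂ φ (weight-+ p q k q)
            (trans (cong (ρ (+ p) (+ q) (weight p k)) (weight-highest q))
                   (ρ-highest (+ p) (+ q) (weight p k) (weight-≥ p k)))

  gridPoint-inner : ∀ p q k m → gridPoint (suc p) (suc q) (suc k) m ≡ gridPoint p q k m
  gridPoint-inner p q k m = cong₂ φ (sum (+ p) (+ q) (+ k) (+ m)) (begin
      ρ (+ suc p) (+ suc q) (weight (suc p) (suc k)) (weight (suc q) m)
    ≡⟨ cong₂ (λ a b → ρ a b (weight (suc p) (suc k)) (weight (suc q) m))
             (ℤₚ.+-comm (+ 1) (+ p)) (ℤₚ.+-comm (+ 1) (+ q)) ⟩
      ρ (+ p + + 1) (+ q + + 1) (weight (suc p) (suc k)) (weight (suc q) m)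
    ≡⟨ cong₂ (ρ (+ p + + 1) (+ q + + 1)) (up (+ p) (+ k)) (down (+ q) (+ m)) ⟩
      ρ (+ p + + 1) (+ q + + 1) (weight p k + + 1) (weight q m - + 1)
    ≡⟨ ρ-shift (+ p) (+ q) (weight p k) (weight q m) (+ 1) ⟩
      ρ (+ p) (+ q) (weight p k) (weight q m) ∎)
    where
      open ≡-Reasoning
      sum : ∀ P Q K M → (+ 1 + K) + (+ 1 + K) - (+ 1 + P) + (M + M - (+ 1 + Q)) ≡ K + K - P + (M + M - Q)
      sum = solve-∀
      up : ∀ P K → (+ 1 + K) + (+ 1 + K) - (+ 1 + P) ≡ K + K - P + + 1
      up = solve-∀
      down : ∀ Q M → M + M - (+ 1 + Q) ≡ M + M - Q - + 1
      down = solve-∀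

grid-hook : ∀ p q φ → ∑< (suc (suc q)) (gridPoint φ (suc p) (suc q) 0)
                      + (∑[ k < suc p ] gridPoint φ (suc p) (suc q) (suc k) (suc q))
                      ≡ string (suc p ℕ.+ suc q) φ
grid-hook p q φ = begin
    ∑< (suc (suc q)) (gridPoint φ (suc p) (suc q) 0) + (∑[ k < suc p ] gridPoint φ (suc p) (suc q) (suc k) (suc q))
  ≡⟨ cong₂ _+_ (∑<-cong (suc (suc q)) (λ m m<2+q → gridPoint-lowest φ (suc p) (suc q) m (ℕₚ.≤-pred m<2+q)))
               (∑<-cong (suc p) (λ k _ → trans (gridPoint-highest φ (suc p) (suc q) (suc k))
                                               (cong f (trans (ℕₚ.+-comm (suc k) (suc q)) (ℕₚ.+-suc (suc q) k))))) ⟩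
    ∑< (suc (suc q)) f + (∑[ k < suc p ] f (suc (suc q) ℕ.+ k))
  ≡⟨ sym (∑<-split (suc (suc q)) (suc p) f) ⟩
    ∑< (suc (suc q) ℕ.+ suc p) f
  ≡⟨ cong (λ n → ∑< (suc n) f) (ℕₚ.+-comm (suc q) (suc p)) ⟩
    string R φ ∎
  where
    open ≡-Reasoning
    R : ℕ
    R = suc p ℕ.+ suc q
    f : ℕ → ℤ
    f j = φ (weight R j) (+ R)

grid≡∑string : ∀ p q φ → grid p q φ ≡ ∑[ r ∈ cgRadii p q ] string r φ
grid≡∑string zero q φ =
  cong (λ s → s + + 0) (∑<-cong (suc q) (λ m m<1+q → gridPoint-lowest φ 0 q m (ℕₚ.≤-pred m<1+q)))
grid≡∑string (suc p) zero φ =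
  trans (∑<-cong (suc (suc p)) (λ k _ →
          trans (ℤₚ.+-identityʳ _)
                (trans (gridPoint-highest φ (suc p) 0 k)
                       (cong₂ (λ a b → φ (weight a b) (+ a)) (ℕₚ.+-identityʳ (suc p)) (ℕₚ.+-identityʳ k)))))
        (sym (ℤₚ.+-identityʳ _))
grid≡∑string (suc p) (suc q) φ = begin
    grid (suc p) (suc q) φ
  ≡⟨ cong (_+_ column) (∑<-cong (suc p) (λ k _ → ∑<-last (suc q) (point (suc k)))) ⟩
    column + (∑[ k < suc p ] (∑< (suc q) (point (suc k)) + point (suc k) (suc q)))
  ≡⟨ cong (_+_ column) (∑<-distrib-+ (suc p) (λ k → ∑< (suc q) (point (suc k))) (λ k → point (suc k) (suc q))) ⟩
    column + (interior + row)
  ≡⟨ rearrange column interior row ⟩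
    column + row + interior
  ≡⟨ cong₂ _+_ (grid-hook p q φ)
               (trans (∑<-cong (suc p) (λ k _ → ∑<-cong (suc q) (λ m _ → gridPoint-inner φ p q k m)))
                      (grid≡∑string p q φ)) ⟩
    string (suc p ℕ.+ suc q) φ + (∑[ r ∈ cgRadii p q ] string r φ) ∎
  where
    open ≡-Reasoning
    point : ℕ → ℕ → ℤ
    point = gridPoint φ (suc p) (suc q)
    column interior row : ℤ
    column   = ∑< (suc (suc q)) (point 0)
    interior = ∑[ k < suc p ] ∑< (suc q) (point (suc k))
    row      = ∑[ k < suc p ] point (suc k) (suc q)
    rearrange : ∀ a b c → a + (b + c) ≡ a + c + b
    rearrange = solve-∀

Decomposes : ((ℤ → ℤ → ℤ) → ℤ) → List ℕ → Set
Decomposes F radii = ∀ φ → F φ ≡ ∑[ r ∈ radii ] string r φ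

_⊗_ : ((ℤ → ℤ → ℤ) → ℤ) → ((ℤ → ℤ → ℤ) → ℤ) → (ℤ → ℤ → ℤ) → ℤ
(F ⊗ G) φ = F (λ d r → G (λ d′ r′ → φ (d + d′) (ρ r r′ d d′)))

tensorRadii : List ℕ → List ℕ → List ℕ
tensorRadii Rs Ss = concatMap (λ a → concatMap (cgRadii a) Ss) Rs

string-decomposes : ∀ r → Decomposes (string r) (r ∷ [])
string-decomposes r φ = sym (ℤₚ.+-identityʳ _)

⊗-decomposes : ∀ {F G Rs Ss} → Decomposes F Rs → Decomposes G Ss → Decomposes (F ⊗ G) (tensorRadii Rs Ss)
⊗-decomposes {F} {G} {Rs} {Ss} F≈ G≈ φ = begin
    (F ⊗ G) φ
  ≡⟨ F≈ _ ⟩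
    ∑[ a ∈ Rs ] ∑[ k < suc a ] G (λ d′ r′ → φ (weight a k + d′) (ρ (+ a) r′ (weight a k) d′))
  ≡⟨ ∑-cong Rs (λ a → ∑<-cong (suc a) (λ k _ →
       G≈ (λ d′ r′ → φ (weight a k + d′) (ρ (+ a) r′ (weight a k) d′)))) ⟩
    ∑[ a ∈ Rs ] ∑[ k < suc a ] ∑[ b ∈ Ss ] string b (λ d′ r′ → φ (weight a k + d′) (ρ (+ a) r′ (weight a k) d′))
  ≡⟨ ∑-cong Rs (λ a → ∑<-∑ (suc a) (λ k b → gridRow a k b) Ss) ⟩
    ∑[ a ∈ Rs ] ∑[ b ∈ Ss ] grid a b φ
  ≡⟨ ∑-cong Rs (λ a → ∑-cong Ss (λ b → grid≡∑string a b φ)) ⟩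
    ∑[ a ∈ Rs ] ∑[ b ∈ Ss ] ∑[ r ∈ cgRadii a b ] string r φ
  ≡⟨ sym (trans (∑-concatMap (λ r → string r φ) (λ a → concatMap (cgRadii a) Ss) Rs)
                (∑-cong Rs (λ a → ∑-concatMap (λ r → string r φ) (cgRadii a) Ss))) ⟩
    ∑[ r ∈ tensorRadii Rs Ss ] string r φ ∎
  where
    open ≡-Reasoning
    gridRow : ℕ → ℕ → ℕ → ℤ
    gridRow a k b = ∑[ m < suc b ] gridPoint φ a b k m

∑-decomposes : {A : Set} {F : A → (ℤ → ℤ → ℤ) → ℤ} {radii : A → List ℕ} (xs : List A) →
               (∀ x → Decomposes (F x) (radii x)) → Decomposes (λ φ → ∑[ x ∈ xs ] F x φ) (concatMap radii xs)
∑-decomposes {F = F} {radii} xs F≈ φ =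
  trans (∑-cong xs (λ x → F≈ x φ)) (sym (∑-concatMap (λ r → string r φ) radii xs))

indicator-decomposes : ∀ {F Rs} (b : Bool) → Decomposes F Rs →
                Decomposes (λ φ → [ b ] F φ) (if b then Rs else [])
indicator-decomposes true  F≈ = F≈
indicator-decomposes false F≈ φ = refl

infix 4 _≼_

record _≼_ (r s : ℕ) : Set where
  constructor gap
  field
    halfGap : ℕ
    r+gap≡s : r ℕ.+ (halfGap ℕ.+ halfGap) ≡ s

≼-refl : ∀ r → r ≼ r
≼-refl r = gap 0 (ℕₚ.+-identityʳ r)

≼-trans : ∀ {a b c} → a ≼ b → b ≼ c → a ≼ c
≼-trans {a} (gap h refl) (gap h′ refl) = gap (h ℕ.+ h′) (lemma a h h′)
  where lemma : ∀ a h h′ → a ℕ.+ ((h ℕ.+ h′) ℕ.+ (h ℕ.+ h′)) ≡ a ℕ.+ (h ℕ.+ h) ℕ.+ (h′ ℕ.+ h′)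
        lemma = ℕ-Solver.solve-∀

+-mono-≼ : ∀ {a b c d} → a ≼ b → c ≼ d → a ℕ.+ c ≼ b ℕ.+ d
+-mono-≼ {a} {c = c} (gap h refl) (gap h′ refl) = gap (h ℕ.+ h′) (lemma a c h h′)
  where lemma : ∀ a c h h′ →
                a ℕ.+ c ℕ.+ ((h ℕ.+ h′) ℕ.+ (h ℕ.+ h′)) ≡ a ℕ.+ (h ℕ.+ h) ℕ.+ (c ℕ.+ (h′ ℕ.+ h′))
        lemma = ℕ-Solver.solve-∀

cgRadii-≼ : ∀ p q → All (_≼ p ℕ.+ q) (cgRadii p q)
cgRadii-≼ zero    q       = ≼-refl q ∷ []
cgRadii-≼ (suc p) zero    = gap 0 refl ∷ []
cgRadii-≼ (suc p) (suc q) = ≼-refl _ ∷ All.map (λ r≼p+q → ≼-trans r≼p+q (gap 1 (lemma p q))) (cgRadii-≼ p q)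
  where lemma : ∀ p q → p ℕ.+ q ℕ.+ 2 ≡ suc p ℕ.+ suc q
        lemma = ℕ-Solver.solve-∀

cgRadii-∋ : ∀ p q → p ℕ.+ q ∈ cgRadii p q
cgRadii-∋ zero    q       = here refl
cgRadii-∋ (suc p) zero    = here (ℕₚ.+-identityʳ (suc p))
cgRadii-∋ (suc p) (suc q) = here refl

tensorRadii-≼ : ∀ {A B Rs Ss} → All (_≼ A) Rs → All (_≼ B) Ss → All (_≼ A ℕ.+ B) (tensorRadii Rs Ss)
tensorRadii-≼ Rs≼A Ss≼B =
  All-concatMap⁺ (All.map (λ {a} a≼A → All-concatMap⁺ (All.map (λ {b} b≼B →
    All.map (λ r≼a+b → ≼-trans r≼a+b (+-mono-≼ a≼A b≼B)) (cgRadii-≼ a b)) Ss≼B)) Rs≼A)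

tensorRadii-∋ : ∀ {A B Rs Ss} → A ∈ Rs → B ∈ Ss → A ℕ.+ B ∈ tensorRadii Rs Ss
tensorRadii-∋ {A} {B} {Ss = Ss} A∈Rs B∈Ss =
  ∈-concatMap⁺ (λ a → concatMap (cgRadii a) Ss) (lose A∈Rs (∈-concatMap⁺ (cgRadii A) (lose B∈Ss (cgRadii-∋ A B))))

sgn-neg : ∀ i → sgn (- i) ≡ - sgn i
sgn-neg (+ zero)   = refl
sgn-neg +[1+ n ]   = refl
sgn-neg -[1+ n ]   = refl

-- evalL u i is the value on L(h̃ᵢ) of the functional h_m ↦ u m on CH₂.
evalL : (ℕ → ℤ) → ℤ → ℤ
evalL u i = sgn (i + + 1) * u (∣ i + + 1 ∣ ∸ 1)

evalL-nonneg : ∀ u {i} → + 0 ≤ i → evalL u i ≡ u ∣ i ∣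
evalL-nonneg u {+ n} _ rewrite ℕₚ.+-comm n 1 = ℤₚ.*-identityˡ (u n)

evalL-reflect : ∀ u i → evalL u (- i - + 2) ≡ - evalL u i
evalL-reflect u i = begin
    sgn (- i - + 2 + + 1) * u (∣ - i - + 2 + + 1 ∣ ∸ 1)
  ≡⟨ cong (λ j → sgn j * u (∣ j ∣ ∸ 1)) (mirror i) ⟩
    sgn (- (i + + 1)) * u (∣ - (i + + 1) ∣ ∸ 1)
  ≡⟨ cong₂ (λ s a → s * u (a ∸ 1)) (sgn-neg (i + + 1)) (ℤₚ.∣-i∣≡∣i∣ (i + + 1)) ⟩
    - sgn (i + + 1) * u (∣ i + + 1 ∣ ∸ 1)
  ≡⟨ sym (ℤₚ.neg-distribˡ-* (sgn (i + + 1)) _) ⟩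
    - evalL u i ∎
  where
    open ≡-Reasoning
    mirror : ∀ i → - i - + 2 + + 1 ≡ - (i + + 1)
    mirror = solve-∀

evalKept : ℕ → (ℕ → ℤ) → ℤ → ℤ → ℤ
evalKept C u d r = [ ((r - + C) ⊔ + 0) ≤ᵇ (d + + C) ] u ∣ d + + C ∣

evalL-agrees : ∀ C u d r → + 0 ≤ d + + C → (r - + C) ⊔ + 0 ≤ d + + C →
               evalL u (d + + C) ≡ evalKept C u d r
evalL-agrees C u d r 0≤i kept = trans (evalL-nonneg u 0≤i) (sym (if-true (ℤₚ.≤⇒≤ᵇ kept)))

module _ (C : ℕ) (u : ℕ → ℤ) where

  foldedL : ℕ → ℕ → ℤ
  foldedL r k = evalL u (weight r k + + C)

  kept : ℕ → ℕ → ℤ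
  kept r k = evalKept C u (weight r k) (+ r)

  private
    threshold : ∀ g → (+ suc (C ℕ.+ g) - + C) ⊔ + 0 ≡ + suc g
    threshold g = cong (_⊔ + 0) (lemma (+ C) (+ g))
      where lemma : ∀ C G → + 1 + (C + G) - C ≡ + 1 + G
            lemma = solve-∀

  foldedL-antipodal : ∀ g k → k ℕ.< suc g →
                      foldedL (suc (C ℕ.+ g)) (suc g ∸ suc k) ≡ - foldedL (suc (C ℕ.+ g)) k
  foldedL-antipodal g k (s≤s k≤g) with ℕₚ.m≤n⇒∃[o]m+o≡n k≤g
  ... | j , refl rewrite ℕₚ.m+n∸m≡n k j =
    trans (cong (evalL u) (mirror (+ C) (+ k) (+ j))) (evalL-reflect u (weight (suc (C ℕ.+ (k ℕ.+ j))) k + + C))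
    where mirror : ∀ C K J → J + J - (+ 1 + (C + (K + J))) + C ≡ - (K + K - (+ 1 + (C + (K + J))) + C) - + 2
          mirror = solve-∀

  kept-below : ∀ g k → k ℕ.≤ g → kept (suc (C ℕ.+ g)) k ≡ + 0
  kept-below g k k≤g with ℕₚ.m≤n⇒∃[o]m+o≡n k≤g
  ... | j , refl = if-false (ℤₚ.<⇒≱ below ∘ ℤₚ.≤ᵇ⇒≤)
    where
      below : weight (suc (C ℕ.+ (k ℕ.+ j))) k + + C < (+ suc (C ℕ.+ (k ℕ.+ j)) - + C) ⊔ + 0
      below = subst (weight (suc (C ℕ.+ (k ℕ.+ j))) k + + C <_) (sym (threshold (k ℕ.+ j)))
                    (<-by (weight (suc (C ℕ.+ (k ℕ.+ j))) k + + C) (+ suc (k ℕ.+ j)) (suc (j ℕ.+ j)) (lemma (+ C) (+ k) (+ j)))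
        where lemma : ∀ C K J → + 1 + (K + J) ≡ K + K - (+ 1 + (C + (K + J))) + C + (+ 1 + (+ 1 + (J + J)))
              lemma = solve-∀

  kept-above : ∀ g k → foldedL (suc (C ℕ.+ g)) (suc g ℕ.+ k) ≡ kept (suc (C ℕ.+ g)) (suc g ℕ.+ k)
  kept-above g k = evalL-agrees C u (weight (suc (C ℕ.+ g)) (suc g ℕ.+ k)) (+ suc (C ℕ.+ g))
                                 (ℤₚ.≤-trans (+≤+ z≤n) above)
                                 (subst (_≤ weight (suc (C ℕ.+ g)) (suc g ℕ.+ k) + + C) (sym (threshold g)) above)
    where
      above : + suc g ≤ weight (suc (C ℕ.+ g)) (suc g ℕ.+ k) + + C
      above = ≤-by (+ suc g) (weight (suc (C ℕ.+ g)) (suc g ℕ.+ k) + + C) (k ℕ.+ k) (lemma (+ C) (+ g) (+ k))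
        where lemma : ∀ C G K → (+ 1 + G + K) + (+ 1 + G + K) - (+ 1 + (C + G)) + C ≡ + 1 + G + (K + K)
              lemma = solve-∀

  -- For r > C the first r − C weights pair off across −1 and cancel under L; they are exactly
  -- the weights failing the RV′ condition.
  string-foldedL≡kept : ∀ r → ∑< (suc r) (foldedL r) ≡ ∑< (suc r) (kept r)
  string-foldedL≡kept r with r ℕ.≤? C
  ... | yes r≤C = ∑<-cong (suc r) (λ k _ →
          evalL-agrees C u (weight r k) (+ r) (nonneg k) (subst (_≤ weight r k + + C) (sym noThreshold) (nonneg k)))
    where
      nonneg : ∀ k → + 0 ≤ weight r k + + C
      nonneg k = subst (_≤ weight r k + + C) (ℤₚ.+-inverseˡ (+ r)) (ℤₚ.+-mono-≤ (weight-≥ r k) (+≤+ r≤C))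
      noThreshold : (+ r - + C) ⊔ + 0 ≡ + 0
      noThreshold = ℤₚ.i≤j⇒i⊔j≡j (ℤₚ.i≤j⇒i-j≤0 (+≤+ r≤C))
  ... | no r≰C with ℕₚ.m≤n⇒∃[o]m+o≡n (ℕₚ.≰⇒> r≰C)
  ... | g , refl = begin
      ∑< (suc R) (foldedL R)
    ≡⟨ cong (λ n → ∑< n (foldedL R)) size ⟩
      ∑< (suc g ℕ.+ suc C) (foldedL R)
    ≡⟨ ∑<-split (suc g) (suc C) (foldedL R) ⟩
      ∑< (suc g) (foldedL R) + (∑[ k < suc C ] foldedL R (suc g ℕ.+ k))
    ≡⟨ cong₂ _+_ (trans (∑<-antisymmetric (suc g) (foldedL R) (foldedL-antipodal g))
                        (sym (trans (∑<-cong (suc g) (λ k k<1+g → kept-below g k (ℕₚ.≤-pred k<1+g))) (∑<-zero (suc g)))))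
                 (∑<-cong (suc C) (λ k _ → kept-above g k)) ⟩
      ∑< (suc g) (kept R) + (∑[ k < suc C ] kept R (suc g ℕ.+ k))
    ≡⟨ sym (∑<-split (suc g) (suc C) (kept R)) ⟩
      ∑< (suc g ℕ.+ suc C) (kept R)
    ≡⟨ cong (λ n → ∑< n (kept R)) (sym size) ⟩
      ∑< (suc R) (kept R) ∎
    where
      open ≡-Reasoning
      R : ℕ
      R = suc (C ℕ.+ g)
      size : suc R ≡ suc g ℕ.+ suc C
      size = cong suc (trans (cong suc (ℕₚ.+-comm C g)) (sym (ℕₚ.+-suc g C)))

Even : ℤ → Set
Even x = ∃[ y ] x ≡ y + y

Even-+ : ∀ {a b} → Even a → Even b → Even (a + b)
Even-+ (y , refl) (z , refl) = y + z , lemma y z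
  where lemma : ∀ y z → y + y + (z + z) ≡ y + z + (y + z)
        lemma = solve-∀

isEven-+2 : ∀ x → isEven (x + + 2) ≡ isEven x
isEven-+2 (+ n)                = cong (λ m → m ℕ.% 2 ℕ.≡ᵇ 0) (ℕₚ.+-comm n 2)
isEven-+2 -[1+ 0 ]             = refl
isEven-+2 -[1+ 1 ]             = refl
isEven-+2 -[1+ suc (suc n) ]   = refl

isEven-+double : ∀ x y → isEven (x + (y + y)) ≡ isEven x
isEven-+double x (+ k) = go x k
  where
    go : ∀ x k → isEven (x + (+ k + + k)) ≡ isEven x
    go x zero    = cong isEven (ℤₚ.+-identityʳ x)
    go x (suc k) = trans (cong isEven (lemma x (+ k))) (trans (isEven-+2 (x + (+ k + + k))) (go x k))
      where lemma : ∀ x k → x + ((+ 1 + k) + (+ 1 + k)) ≡ x + (k + k) + + 2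
            lemma = solve-∀
isEven-+double x y@(-[1+ k ]) =
  sym (trans (cong isEven (lemma x y)) (isEven-+double (x + (y + y)) (- y)))
  where lemma : ∀ x y → x ≡ x + (y + y) + (- y + - y)
        lemma = solve-∀

Even-abs : ∀ x → Even (+ ∣ x ∣) → Even x
Even-abs (+ n)    even     = even
Even-abs -[1+ n ] (y , eq) = - y , trans (cong (λ i → - i) eq) (ℤₚ.neg-distrib-+ y y)

isEven⇒Even : ∀ x → T (isEven x) → Even x
isEven⇒Even x even = Even-abs x (+ half , cong +_ (begin
    ∣ x ∣                           ≡⟨ m≡m%n+[m/n]*n ∣ x ∣ 2 ⟩
    ∣ x ∣ ℕ.% 2 ℕ.+ half ℕ.* 2      ≡⟨ cong (ℕ._+ half ℕ.* 2) (ℕₚ.≡ᵇ⇒≡ (∣ x ∣ ℕ.% 2) 0 even) ⟩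
    half ℕ.* 2                      ≡⟨ ℕₚ.*-comm half 2 ⟩
    half ℕ.+ (half ℕ.+ 0)           ≡⟨ cong (half ℕ.+_) (ℕₚ.+-identityʳ half) ⟩
    half ℕ.+ half                   ∎))
  where
    open ≡-Reasoning
    half : ℕ
    half = ∣ x ∣ ℕ./ 2

∑<-evens : (N : ℕ) (H : ℕ → ℤ) →
           ∑[ j < suc (N ℕ.+ N) ] [ j ℕ.% 2 ℕ.≡ᵇ 0 ] H j ≡ ∑[ k < suc N ] H (k ℕ.+ k)
∑<-evens zero    H = refl
∑<-evens (suc N) H = begin
    ∑< (suc (suc N ℕ.+ suc N)) evenPart
  ≡⟨ cong (λ m → ∑< (suc (suc m)) evenPart) (ℕₚ.+-suc N N) ⟩
    H 0 + (+ 0 + (∑[ j < suc (N ℕ.+ N) ] evenPart (suc (suc j))))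
  ≡⟨ cong (_+_ (H 0)) (trans (ℤₚ.+-identityˡ _) (∑<-evens N (H ∘ suc ∘ suc))) ⟩
    H 0 + (∑[ k < suc N ] H (suc (suc (k ℕ.+ k))))
  ≡⟨ cong (_+_ (H 0)) (∑<-cong (suc N) (λ k _ → cong (H ∘ suc) (sym (ℕₚ.+-suc k k)))) ⟩
    ∑[ k < suc (suc N) ] H (k ℕ.+ k) ∎
  where
    open ≡-Reasoning
    evenPart : ℕ → ℤ
    evenPart j = [ j ℕ.% 2 ℕ.≡ᵇ 0 ] H j

evensAround : ℤ → ℤ → List ℤ
evensAround c t = filter (λ l → T? (isEven l)) (interval (c - t) (c + t))

∑-evensAround : ∀ c T (F : ℤ → ℤ) → Even c → Even (+ T) →
                ∑ F (evensAround c (+ T)) ≡ ∑[ k < suc T ] F (c + weight T k)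
∑-evensAround c T F (y , refl) (z , T≡z+z) = begin
    ∑ F (filter (λ l → T? (isEven l)) (interval low (y + y + + T)))
  ≡⟨ cong (λ xs → ∑ F (filter (λ l → T? (isEven l)) xs)) interval≡ ⟩
    ∑ F (filter (λ l → T? (isEven l)) (map (λ j → low + + j) (upTo (suc (T ℕ.+ T)))))
  ≡⟨ ∑-filter isEven F (map (λ j → low + + j) (upTo (suc (T ℕ.+ T)))) ⟩
    ∑[ l ∈ map (λ j → low + + j) (upTo (suc (T ℕ.+ T))) ] [ isEven l ] F l
  ≡⟨ ∑-map (λ l → [ isEven l ] F l) (λ j → low + + j) (upTo (suc (T ℕ.+ T))) ⟩
    ∑[ j ∈ upTo (suc (T ℕ.+ T)) ] [ isEven (low + + j) ] F (low + + j)
  ≡⟨ ∑-applyUpTo (λ j → [ isEven (low + + j) ] F (low + + j)) (λ j → j) (suc (T ℕ.+ T)) ⟩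
    ∑[ j < suc (T ℕ.+ T) ] [ isEven (low + + j) ] F (low + + j)
  ≡⟨ ∑<-cong (suc (T ℕ.+ T)) (λ j _ → cong (λ b → [ b ] F (low + + j)) (parity j)) ⟩
    ∑[ j < suc (T ℕ.+ T) ] [ j ℕ.% 2 ℕ.≡ᵇ 0 ] F (low + + j)
  ≡⟨ ∑<-evens T (λ j → F (low + + j)) ⟩
    ∑[ k < suc T ] F (low + + (k ℕ.+ k))
  ≡⟨ ∑<-cong (suc T) (λ k _ → cong F (recentre y (+ T) (+ k))) ⟩
    ∑[ k < suc T ] F (y + y + weight T k) ∎
  where
    open ≡-Reasoning
    low : ℤ
    low = y + y - + T
    interval≡ : interval low (y + y + + T) ≡ map (λ j → low + + j) (upTo (suc (T ℕ.+ T)))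
    interval≡ = trans (if-true (ℤₚ.≤⇒≤ᵇ (≤-by low (y + y + + T) (T ℕ.+ T) (lemma₁ y (+ T)))))
                      (cong (λ d → map (λ j → low + + j) (upTo (suc ∣ d ∣))) (lemma₂ y (+ T)))
      where lemma₁ : ∀ y t → y + y + t ≡ y + y - t + (t + t)
            lemma₁ = solve-∀
            lemma₂ : ∀ y t → y + y + t - (y + y - t) ≡ t + t
            lemma₂ = solve-∀
    parity : ∀ j → isEven (low + + j) ≡ (j ℕ.% 2 ℕ.≡ᵇ 0)
    parity j = trans (cong (λ t → isEven (y + y - t + + j)) T≡z+z)
                     (trans (cong isEven (lemma y z (+ j))) (isEven-+double (+ j) (y - z)))
      where lemma : ∀ y z j → y + y - (z + z) + j ≡ j + ((y - z) + (y - z))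
            lemma = solve-∀
    recentre : ∀ y t k → y + y - t + (k + k) ≡ y + y + (k + k - t)
    recentre = solve-∀

inRV' : ℕ → Tree → Bool
inRV' n t = ((rad n t - pow2 (suc n)) ⊔ + 0) ≤ᵇ val t

∑-RV-suc : ∀ n (G : Tree → ℤ) → ∑ G (RV (suc n)) ≡
  ∑[ t₁ ∈ RV n ] ∑[ t₂ ∈ RV n ] ∑[ t₃ ∈ RV n ]
    ∑[ l ∈ evensAround (val t₁ + val t₃) (τ (val t₂)) ] G (node l t₁ t₂ t₃)
∑-RV-suc n G =
  trans (∑-concatMap G _ (RV n)) (∑-cong (RV n) λ t₁ →
  trans (∑-concatMap G _ (RV n)) (∑-cong (RV n) λ t₂ →
  trans (∑-concatMap G _ (RV n)) (∑-cong (RV n) λ t₃ →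
  ∑-map G (λ l → node l t₁ t₂ t₃) (evensAround (val t₁ + val t₃) (τ (val t₂))))))

∑-RV' : ∀ n (f : Tree → ℤ) → ∑ f (RV' n) ≡ ∑[ t ∈ RV n ] [ plus n t ∧ inRV' n t ] f t
∑-RV' n f = trans (∑-filter (inRV' n) f (RV⁺ n))
                  (trans (∑-filter (plus n) _ (RV n)) (∑-cong (RV n) (λ t → sym (if-∧ (plus n t)))))

∑-RV⁺-suc : ∀ n (G : Tree → ℤ) → ∑ G (RV⁺ (suc n)) ≡
  ∑[ t₁ ∈ RV⁺ n ] ∑[ t₂ ∈ RV' n ] ∑[ t₃ ∈ RV⁺ n ]
    ∑[ l ∈ evensAround (val t₁ + val t₃) (τ (val t₂)) ] G (node l t₁ t₂ t₃)
∑-RV⁺-suc n G = begin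
    ∑ G (RV⁺ (suc n))
  ≡⟨ ∑-filter (plus (suc n)) G (RV (suc n)) ⟩
    ∑[ t ∈ RV (suc n) ] [ plus (suc n) t ] G t
  ≡⟨ ∑-RV-suc n _ ⟩
    ∑[ t₁ ∈ RV n ] ∑[ t₂ ∈ RV n ] ∑[ t₃ ∈ RV n ] ∑[ l ∈ around t₁ t₂ t₃ ]
      ([ plus n t₁ ∧ plus n t₂ ∧ plus n t₃ ∧ inRV' n t₂ ] G (node l t₁ t₂ t₃))
  ≡⟨ ∑-cong (RV n) (λ t₁ → ∑-cong (RV n) (λ t₂ → ∑-cong (RV n) (λ t₃ →
       trans (∑-indicator (plus n t₁ ∧ plus n t₂ ∧ plus n t₃ ∧ inRV' n t₂)
                          (λ l → G (node l t₁ t₂ t₃)) (around t₁ t₂ t₃))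
             (nested (plus n t₁) (plus n t₂) (plus n t₃) (inRV' n t₂))))) ⟩
    ∑[ t₁ ∈ RV n ] ∑[ t₂ ∈ RV n ] ∑[ t₃ ∈ RV n ]
      [ plus n t₁ ] [ plus n t₂ ∧ inRV' n t₂ ] [ plus n t₃ ] Q t₁ t₂ t₃
  ≡⟨ ∑-cong (RV n) (λ t₁ → trans (∑-cong (RV n) (λ t₂ → ∑-indicator (plus n t₁) _ (RV n)))
                                 (∑-indicator (plus n t₁) _ (RV n))) ⟩
    ∑[ t₁ ∈ RV n ] [ plus n t₁ ] ∑[ t₂ ∈ RV n ] ∑[ t₃ ∈ RV n ]
      [ plus n t₂ ∧ inRV' n t₂ ] [ plus n t₃ ] Q t₁ t₂ t₃
  ≡⟨ ∑-cong (RV n) (λ t₁ → cong [ plus n t₁ ]_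
       (∑-cong (RV n) (λ t₂ → ∑-indicator (plus n t₂ ∧ inRV' n t₂) _ (RV n)))) ⟩
    ∑[ t₁ ∈ RV n ] [ plus n t₁ ] ∑[ t₂ ∈ RV n ] [ plus n t₂ ∧ inRV' n t₂ ]
      ∑[ t₃ ∈ RV n ] [ plus n t₃ ] Q t₁ t₂ t₃
  ≡⟨ sym (trans (∑-filter (plus n) _ (RV n)) (∑-cong (RV n) (λ t₁ → cong [ plus n t₁ ]_
       (trans (∑-RV' n _) (∑-cong (RV n) (λ t₂ → cong [ plus n t₂ ∧ inRV' n t₂ ]_
         (∑-filter (plus n) _ (RV n)))))))) ⟩
    ∑[ t₁ ∈ RV⁺ n ] ∑[ t₂ ∈ RV' n ] ∑[ t₃ ∈ RV⁺ n ] Q t₁ t₂ t₃ ∎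
  where
    open ≡-Reasoning
    around : Tree → Tree → Tree → List ℤ
    around t₁ t₂ t₃ = evensAround (val t₁ + val t₃) (τ (val t₂))
    Q : Tree → Tree → Tree → ℤ
    Q t₁ t₂ t₃ = ∑[ l ∈ around t₁ t₂ t₃ ] G (node l t₁ t₂ t₃)
    nested : ∀ a b c d {x : ℤ} → [ a ∧ b ∧ c ∧ d ] x ≡ [ a ] [ b ∧ d ] [ c ] x
    nested false b     c d = refl
    nested true  false c d = refl
    nested true  true  c d = trans (if-∧ c) (if-swap-then c d)

RV-even : ∀ n → All (Even ∘ val) (RV n)
RV-even zero    = (+ 1 , refl) ∷ []
RV-even (suc n) =
  All-concatMap⁺ (All.universal (λ t₁ → All-concatMap⁺ (All.universal (λ t₂ →
    All-concatMap⁺ (All.universal (λ t₃ → All.map⁺ (evensAround-even (val t₁ + val t₃) (τ (val t₂)))) (RV n)))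
      (RV n))) (RV n))
  where
    evensAround-even : ∀ c t → All Even (evensAround c t)
    evensAround-even c t = All.map (λ {l} → isEven⇒Even l) (All.all-filter (λ l → T? (isEven l)) (interval (c - t) (c + t)))

RV⁺-even : ∀ n → All (Even ∘ val) (RV⁺ n)
RV⁺-even n = All.filter⁺ (λ t → T? (plus n t)) (RV-even n)

RV'-even : ∀ n → All (Even ∘ val) (RV' n)
RV'-even n = All.filter⁺ (λ t → T? (inRV' n t)) (RV⁺-even n)

RV'-inRV' : ∀ n → All (T ∘ inRV' n) (RV' n)
RV'-inRV' n = All.all-filter (λ t → T? (inRV' n t)) (RV⁺ n)

inRV'⇒nonneg : ∀ n t → T (inRV' n t) → + 0 ≤ val t
inRV'⇒nonneg n t kept = ℤₚ.≤-trans (ℤₚ.i≤j⊔i (rad n t - pow2 (suc n)) (+ 0)) (ℤₚ.≤ᵇ⇒≤ kept)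

τ-nonneg : ∀ {i} → + 0 ≤ i → τ i ≡ + ∣ i ∣
τ-nonneg {+ n} _ = lemma (+ n)
  where lemma : ∀ i → i + + 1 - + 1 ≡ i
        lemma = solve-∀

statistic : ℕ → (ℤ → ℤ → ℤ) → ℤ
statistic n φ = ∑[ t ∈ RV⁺ n ] φ (ind n t) (rad n t)

val≡ind+2ⁿ⁺¹ : ∀ n t → val t ≡ ind n t + pow2 (suc n)
val≡ind+2ⁿ⁺¹ n t = lemma (val t) (pow2 (suc n))
  where lemma : ∀ v c → v ≡ v - c + c
        lemma = solve-∀

module _ (n : ℕ) (φ : ℤ → ℤ → ℤ) where

  nodeStatistic : Tree → Tree → Tree → ℤ
  nodeStatistic t₁ t₂ t₃ =
    ∑[ k < suc ∣ val t₂ ∣ ] φ (ind n t₁ + ind n t₃ + weight ∣ val t₂ ∣ k)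
                             (ρ (ρ (rad n t₁) (rad n t₃) (ind n t₁) (ind n t₃)) (+ ∣ val t₂ ∣)
                                (ind n t₁ + ind n t₃) (weight ∣ val t₂ ∣ k))

  ∑-evensAround-node : ∀ t₁ t₂ t₃ → Even (val t₁) → Even (val t₂) → T (inRV' n t₂) → Even (val t₃) →
    ∑[ l ∈ evensAround (val t₁ + val t₃) (τ (val t₂)) ]
      φ (ind (suc n) (node l t₁ t₂ t₃)) (rad (suc n) (node l t₁ t₂ t₃))
    ≡ nodeStatistic t₁ t₂ t₃
  ∑-evensAround-node t₁ t₂ t₃ e₁ e₂ kept₂ e₃ rewrite τ-nonneg (inRV'⇒nonneg n t₂ kept₂) =
    trans (∑-evensAround (val t₁ + val t₃) ∣ val t₂ ∣ _ (Even-+ e₁ e₃)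
                         (subst Even (sym (ℤₚ.0≤i⇒+∣i∣≡i (inRV'⇒nonneg n t₂ kept₂))) e₂))
          (∑<-cong (suc ∣ val t₂ ∣) (λ k _ → cong₂ φ
            (recentre (val t₁) (val t₃) (weight ∣ val t₂ ∣ k) (pow2 (suc n)))
            (cong (ρ (ρ (rad n t₁) (rad n t₃) (ind n t₁) (ind n t₃)) (+ ∣ val t₂ ∣) (ind n t₁ + ind n t₃))
                  (offset (val t₁) (val t₃) (weight ∣ val t₂ ∣ k)))))
    where
      recentre : ∀ v₁ v₃ w c → v₁ + v₃ + w - (c + (c + + 0)) ≡ v₁ - c + (v₃ - c) + w
      recentre = solve-∀
      offset : ∀ v₁ v₃ w → v₁ + v₃ + w - v₁ - v₃ ≡ w
      offset = solve-∀

  statistic-suc : statistic (suc n) φ ≡ ∑[ t₂ ∈ RV' n ] ((statistic n ⊗ statistic n) ⊗ string ∣ val t₂ ∣) φ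
  statistic-suc =
    trans (∑-RV⁺-suc n (λ t → φ (ind (suc n) t) (rad (suc n) t)))
    (trans (∑-cong-All (RV⁺-even n) (λ {t₁} e₁ →
              ∑-cong-All (All.zip (RV'-even n , RV'-inRV' n)) (λ {t₂} (e₂ , kept₂) →
                ∑-cong-All (RV⁺-even n) (λ {t₃} e₃ → ∑-evensAround-node t₁ t₂ t₃ e₁ e₂ kept₂ e₃))))
           (∑-comm (λ t₁ t₂ → ∑[ t₃ ∈ RV⁺ n ] nodeStatistic t₁ t₂ t₃) (RV⁺ n) (RV' n)))

-- A string in T₁ ⊗ T₃ ⊗ V_{val T₂} has radius at most 2 · maxRadius n + val T₂, and
-- val T₂ = ind T₂ + 2ⁿ⁺¹ ≤ maxRadius n + 2ⁿ⁺¹.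
maxRadius : ℕ → ℕ
maxRadius zero    = 0
maxRadius (suc n) = (maxRadius n ℕ.+ maxRadius n) ℕ.+ (maxRadius n ℕ.+ 2 ^ suc n)

record StringDecomposition (n : ℕ) : Set where
  field
    radii      : List ℕ
    decomposes : Decomposes (statistic n) radii
    radii-≼    : All (_≼ maxRadius n) radii
    maxRadius∈ : maxRadius n ∈ radii

module DecompositionStep {n : ℕ} (D : StringDecomposition n) where
  open StringDecomposition D

  C : ℕ
  C = 2 ^ suc n

  keptAt : ℕ → ℕ → Bool
  keptAt b k = ((+ b - + C) ⊔ + 0) ≤ᵇ (weight b k + + C)

  valueAt : ℕ → ℕ → ℕ
  valueAt b k = ∣ weight b k + + C ∣

  tensorWithString : ℕ → (ℤ → ℤ → ℤ) → ℤ
  tensorWithString v = (statistic n ⊗ statistic n) ⊗ string v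

  cellRadii : ℕ → ℕ → List ℕ
  cellRadii b k = if keptAt b k then tensorRadii (tensorRadii radii radii) (valueAt b k ∷ []) else []

  nextRadii : List ℕ
  nextRadii = concatMap (λ b → concatMap (cellRadii b) (upTo (suc b))) radii

  cellDecomposes : ∀ b k → Decomposes (λ φ → [ keptAt b k ] tensorWithString (valueAt b k) φ) (cellRadii b k)
  cellDecomposes b k =
    indicator-decomposes (keptAt b k)
      (⊗-decomposes {Rs = tensorRadii radii radii} {Ss = valueAt b k ∷ []}
        (⊗-decomposes {Rs = radii} {Ss = radii} decomposes decomposes) (string-decomposes (valueAt b k)))

  rowDecomposes : ∀ b → Decomposes (λ φ → ∑[ k < suc b ] ([ keptAt b k ] tensorWithString (valueAt b k) φ))
                                   (concatMap (cellRadii b) (upTo (suc b)))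
  rowDecomposes b φ =
    trans (sym (∑-applyUpTo (λ k → [ keptAt b k ] tensorWithString (valueAt b k) φ) (λ k → k) (suc b)))
          (∑-decomposes {F = λ k φ → [ keptAt b k ] tensorWithString (valueAt b k) φ} {radii = cellRadii b}
                        (upTo (suc b)) (cellDecomposes b) φ)

  nextDecomposes : Decomposes (statistic (suc n)) nextRadii
  nextDecomposes φ = begin
      statistic (suc n) φ
    ≡⟨ statistic-suc n φ ⟩
      ∑[ t ∈ RV' n ] tensorWithString ∣ val t ∣ φ
    ≡⟨ ∑-filter (inRV' n) (λ t → tensorWithString ∣ val t ∣ φ) (RV⁺ n) ⟩
      ∑[ t ∈ RV⁺ n ] ([ inRV' n t ] tensorWithString ∣ val t ∣ φ)
    ≡⟨ ∑-cong (RV⁺ n) (λ t → cong (λ v → [ ((rad n t - + C) ⊔ + 0) ≤ᵇ v ] tensorWithString ∣ v ∣ φ)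
                                  (val≡ind+2ⁿ⁺¹ n t)) ⟩
      statistic n (λ d r → [ ((r - + C) ⊔ + 0) ≤ᵇ (d + + C) ] tensorWithString ∣ d + + C ∣ φ)
    ≡⟨ decomposes (λ d r → [ ((r - + C) ⊔ + 0) ≤ᵇ (d + + C) ] tensorWithString ∣ d + + C ∣ φ) ⟩
      ∑[ b ∈ radii ] ∑[ k < suc b ] [ keptAt b k ] tensorWithString (valueAt b k) φ
    ≡⟨ ∑-decomposes {F = λ b φ → ∑[ k < suc b ] [ keptAt b k ] tensorWithString (valueAt b k) φ} radii rowDecomposes φ ⟩
      ∑[ r ∈ nextRadii ] string r φ ∎
    where open ≡-Reasoning

  valueAt-≼ : ∀ b k → b ≼ maxRadius n → k ℕ.≤ b → T (keptAt b k) → valueAt b k ≼ maxRadius n ℕ.+ C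
  valueAt-≼ b k (gap h b+2h≡R) k≤b kept with ℕₚ.m≤n⇒∃[o]m+o≡n k≤b
  ... | e , refl = gap (h ℕ.+ e) (ℤₚ.+-injective (begin
      + valueAt (k ℕ.+ e) k + (+ (h ℕ.+ e) + + (h ℕ.+ e))
    ≡⟨ cong (_+ (+ (h ℕ.+ e) + + (h ℕ.+ e))) (ℤₚ.0≤i⇒+∣i∣≡i nonneg) ⟩
      weight (k ℕ.+ e) k + + C + (+ (h ℕ.+ e) + + (h ℕ.+ e))
    ≡⟨ lemma (+ k) (+ e) (+ h) (+ C) ⟩
      + (k ℕ.+ e ℕ.+ (h ℕ.+ h)) + + C
    ≡⟨ cong (λ m → + m + + C) b+2h≡R ⟩
      + (maxRadius n ℕ.+ C) ∎))
    where
      open ≡-Reasoning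
      nonneg : + 0 ≤ weight (k ℕ.+ e) k + + C
      nonneg = ℤₚ.≤-trans (ℤₚ.i≤j⊔i (+ (k ℕ.+ e) - + C) (+ 0)) (ℤₚ.≤ᵇ⇒≤ kept)
      lemma : ∀ K E H C → K + K - (K + E) + C + ((H + E) + (H + E)) ≡ K + E + (H + H) + C
      lemma = solve-∀

  nextRadii-≼ : All (_≼ maxRadius (suc n)) nextRadii
  nextRadii-≼ = All-concatMap⁺ (All.map (λ {b} b≼R →
    All-concatMap⁺ (All.applyUpTo⁺₁ (λ k → k) (suc b) (λ {k} k<1+b → cell b k b≼R (ℕₚ.≤-pred k<1+b)))) radii-≼)
    where
      cell : ∀ b k → b ≼ maxRadius n → k ℕ.≤ b → All (_≼ maxRadius (suc n)) (cellRadii b k)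
      cell b k b≼R k≤b with keptAt b k in kept
      ... | false = []
      ... | true  = tensorRadii-≼ (tensorRadii-≼ radii-≼ radii-≼)
                                  (valueAt-≼ b k b≼R k≤b (subst T (sym kept) _) ∷ [])

  maxRadius∈nextRadii : maxRadius (suc n) ∈ nextRadii
  maxRadius∈nextRadii =
    ∈-concatMap⁺ (λ b → concatMap (cellRadii b) (upTo (suc b))) (lose maxRadius∈
      (∈-concatMap⁺ (cellRadii R) (lose (∈-upTo⁺ (ℕₚ.n<1+n R))
        (subst (maxRadius (suc n) ∈_) (sym (if-true topKept))
          (subst (λ v → R ℕ.+ R ℕ.+ v ∈ tensorRadii (tensorRadii radii radii) (valueAt R R ∷ [])) topValue
            (tensorRadii-∋ {Ss = valueAt R R ∷ []} (tensorRadii-∋ {Ss = radii} maxRadius∈ maxRadius∈) (here refl)))))))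
    where
      R : ℕ
      R = maxRadius n
      top : weight R R + + C ≡ + R + + C
      top = cong (_+ + C) (weight-highest R)
      topValue : valueAt R R ≡ R ℕ.+ C
      topValue = cong ∣_∣ top
      topKept : T (keptAt R R)
      topKept = ℤₚ.≤⇒≤ᵇ (subst ((+ R - + C) ⊔ + 0 ≤_) (sym top)
                  (ℤₚ.⊔-lub (≤-by (+ R - + C) (+ R + + C) (C ℕ.+ C) (lemma (+ R) (+ C))) (+≤+ z≤n)))
        where lemma : ∀ R C → R + C ≡ R - C + (C + C)
              lemma = solve-∀

  next : StringDecomposition (suc n)
  next = record
    { radii      = nextRadii
    ; decomposes = nextDecomposes
    ; radii-≼    = nextRadii-≼
    ; maxRadius∈ = maxRadius∈nextRadii
    }

stringDecomposition : ∀ n → StringDecomposition n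
stringDecomposition zero    = record
  { radii      = 0 ∷ []
  ; decomposes = λ φ → sym (ℤₚ.+-identityʳ _)
  ; radii-≼    = ≼-refl 0 ∷ []
  ; maxRadius∈ = here refl
  }
stringDecomposition (suc n) = DecompositionStep.next (stringDecomposition n)

∑-evalL-RV⁺ : ∀ n u → ∑[ t ∈ RV⁺ n ] evalL u (val t) ≡ ∑[ t ∈ RV' n ] u ∣ val t ∣
∑-evalL-RV⁺ n u = begin
    ∑[ t ∈ RV⁺ n ] evalL u (val t)
  ≡⟨ ∑-cong (RV⁺ n) (λ t → cong (evalL u) (val≡ind+2ⁿ⁺¹ n t)) ⟩
    statistic n (λ d _ → evalL u (d + + C))
  ≡⟨ decomposes (λ d _ → evalL u (d + + C)) ⟩
    ∑[ r ∈ radii ] string r (λ d _ → evalL u (d + + C))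
  ≡⟨ ∑-cong radii (string-foldedL≡kept C u) ⟩
    ∑[ r ∈ radii ] string r (evalKept C u)
  ≡⟨ sym (decomposes (evalKept C u)) ⟩
    statistic n (evalKept C u)
  ≡⟨ ∑-cong (RV⁺ n) (λ t → cong (λ v → [ ((rad n t - + C) ⊔ + 0) ≤ᵇ v ] u ∣ v ∣)
                                (sym (val≡ind+2ⁿ⁺¹ n t))) ⟩
    ∑[ t ∈ RV⁺ n ] [ inRV' n t ] u ∣ val t ∣
  ≡⟨ sym (∑-filter (inRV' n) (λ t → u ∣ val t ∣) (RV⁺ n)) ⟩
    ∑[ t ∈ RV' n ] u ∣ val t ∣ ∎
  where
    open ≡-Reasoning
    open StringDecomposition (stringDecomposition n)
    C : ℕ
    C = 2 ^ suc n

evalL-τ : ∀ (F : ℤ → ℤ) i → sgn (i + + 1) * F (τ i) ≡ evalL (F ∘ +_) i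
evalL-τ F i = lemma (i + + 1)
  where lemma : ∀ j → sgn j * F (+ ∣ j ∣ - + 1) ≡ sgn j * F (+ (∣ j ∣ ∸ 1))
        lemma (+ zero)  = refl
        lemma +[1+ m ]  = refl
        lemma -[1+ m ]  = refl

∑-RV-suc-signed : ∀ n (w : ℤ → ℤ) → ∑[ t ∈ RV (suc n) ] sgnT t * w (val t) ≡
  ∑[ t₁ ∈ RV n ] sgnT t₁ * (∑[ t₂ ∈ RV n ] sgnT t₂ * (sgn (val t₂ + + 1) *
    (∑[ t₃ ∈ RV n ] sgnT t₃ * (∑[ l ∈ evensAround (val t₁ + val t₃) (τ (val t₂)) ] w l))))
∑-RV-suc-signed n w =
  trans (∑-RV-suc n (λ t → sgnT t * w (val t)))
        (∑-cong (RV n) (λ t₁ → trans (∑-cong (RV n) (λ t₂ → begin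
    ∑[ t₃ ∈ RV n ] ∑[ l ∈ around t₁ t₂ t₃ ] (σ t₂ * (sgnT t₁ * sgnT t₂ * sgnT t₃)) * w l
  ≡⟨ ∑-cong (RV n) (λ t₃ → trans (∑-*ˡ (σ t₂ * (sgnT t₁ * sgnT t₂ * sgnT t₃)) w (around t₁ t₂ t₃))
                                 (regroup (σ t₂) (sgnT t₁) (sgnT t₂) (sgnT t₃) (W t₁ t₂ t₃))) ⟩
    ∑[ t₃ ∈ RV n ] (sgnT t₁ * (sgnT t₂ * σ t₂)) * (sgnT t₃ * W t₁ t₂ t₃)
  ≡⟨ ∑-*ˡ (sgnT t₁ * (sgnT t₂ * σ t₂)) (λ t₃ → sgnT t₃ * W t₁ t₂ t₃) (RV n) ⟩
    (sgnT t₁ * (sgnT t₂ * σ t₂)) * (∑[ t₃ ∈ RV n ] sgnT t₃ * W t₁ t₂ t₃)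
  ≡⟨ reassociate (sgnT t₁) (sgnT t₂) (σ t₂) _ ⟩
    sgnT t₁ * (sgnT t₂ * (σ t₂ * (∑[ t₃ ∈ RV n ] sgnT t₃ * W t₁ t₂ t₃))) ∎))
  (∑-*ˡ (sgnT t₁) _ (RV n))))
  where
    open ≡-Reasoning
    σ : Tree → ℤ
    σ t = sgn (val t + + 1)
    around : Tree → Tree → Tree → List ℤ
    around t₁ t₂ t₃ = evensAround (val t₁ + val t₃) (τ (val t₂))
    W : Tree → Tree → Tree → ℤ
    W t₁ t₂ t₃ = ∑[ l ∈ around t₁ t₂ t₃ ] w l
    regroup : ∀ σ a b c x → (σ * (a * b * c)) * x ≡ (a * (b * σ)) * (c * x)
    regroup = solve-∀
    reassociate : ∀ a b σ x → (a * (b * σ)) * x ≡ a * (b * (σ * x))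
    reassociate = solve-∀

RV-signed : ∀ n (w : ℤ → ℤ) → ∑[ t ∈ RV n ] sgnT t * w (val t) ≡ ∑[ t ∈ RV⁺ n ] w (val t)
RV-signed zero    w = cong (_+ + 0) (ℤₚ.*-identityˡ (w (+ 2)))
RV-signed (suc n) w = begin
    ∑[ t ∈ RV (suc n) ] sgnT t * w (val t)
  ≡⟨ ∑-RV-suc-signed n w ⟩
    ∑[ t₁ ∈ RV n ] sgnT t₁ * (∑[ t₂ ∈ RV n ] sgnT t₂ *
      (σ t₂ * (∑[ t₃ ∈ RV n ] sgnT t₃ * W (val t₁) (τ (val t₂)) (val t₃))))
  ≡⟨ ∑-cong (RV n) (λ t₁ → cong (sgnT t₁ *_) (∑-cong (RV n) (λ t₂ →
       cong (λ s → sgnT t₂ * (σ t₂ * s)) (RV-signed n (W (val t₁) (τ (val t₂))))))) ⟩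
    ∑[ t₁ ∈ RV n ] sgnT t₁ * (∑[ t₂ ∈ RV n ] sgnT t₂ * (σ t₂ * A (val t₁) (τ (val t₂))))
  ≡⟨ ∑-cong (RV n) (λ t₁ → cong (sgnT t₁ *_) (RV-signed n (λ v → sgn (v + + 1) * A (val t₁) (τ v)))) ⟩
    ∑[ t₁ ∈ RV n ] sgnT t₁ * (∑[ t₂ ∈ RV⁺ n ] σ t₂ * A (val t₁) (τ (val t₂)))
  ≡⟨ ∑-cong (RV n) (λ t₁ → cong (sgnT t₁ *_) (trans (∑-cong (RV⁺ n) (λ t₂ → evalL-τ (A (val t₁)) (val t₂)))
                                                     (∑-evalL-RV⁺ n (A (val t₁) ∘ +_)))) ⟩
    ∑[ t₁ ∈ RV n ] sgnT t₁ * (∑[ t₂ ∈ RV' n ] A (val t₁) (+ ∣ val t₂ ∣))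
  ≡⟨ RV-signed n (λ v → ∑[ t₂ ∈ RV' n ] A v (+ ∣ val t₂ ∣)) ⟩
    ∑[ t₁ ∈ RV⁺ n ] ∑[ t₂ ∈ RV' n ] A (val t₁) (+ ∣ val t₂ ∣)
  ≡⟨ ∑-cong (RV⁺ n) (λ t₁ → ∑-cong-All (RV'-inRV' n) (λ {t₂} kept →
       cong (A (val t₁)) (sym (τ-nonneg (inRV'⇒nonneg n t₂ kept))))) ⟩
    ∑[ t₁ ∈ RV⁺ n ] ∑[ t₂ ∈ RV' n ] A (val t₁) (τ (val t₂))
  ≡⟨ sym (∑-RV⁺-suc n (w ∘ val)) ⟩
    ∑[ t ∈ RV⁺ (suc n) ] w (val t) ∎
  where
    open ≡-Reasoning
    σ : Tree → ℤ
    σ t = sgn (val t + + 1)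
    W : ℤ → ℤ → ℤ → ℤ
    W v₁ τ₂ v₃ = ∑[ l ∈ evensAround (v₁ + v₃) τ₂ ] w l
    A : ℤ → ℤ → ℤ
    A v₁ τ₂ = ∑[ t₃ ∈ RV⁺ n ] W v₁ τ₂ (val t₃)

δ : ℤ → ℤ → ℤ
δ a b = [ ⌊ a ℤ.≟ b ⌋ ] + 1

δ-nonneg : ∀ a b → + 0 ≤ δ a b
δ-nonneg a b with ⌊ a ℤ.≟ b ⌋
... | true  = +≤+ z≤n
... | false = +≤+ z≤n

δ-refl : ∀ a → δ a a ≡ + 1
δ-refl a = if-≟-≡ {a} {a} {+ 1} {+ 0} refl

δ-≢ : ∀ {a b} → a ≢ b → δ a b ≡ + 0
δ-≢ {a} {b} = if-≟-≢ {a} {b} {+ 1} {+ 0}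

δ-resp-⇔ : ∀ {a b a′ b′} → (a ≡ b → a′ ≡ b′) → (a′ ≡ b′ → a ≡ b) → δ a b ≡ δ a′ b′
δ-resp-⇔ {a} {b} {a′} {b′} to from with a ℤ.≟ b | a′ ℤ.≟ b′
... | yes _   | yes _    = refl
... | yes a≡b | no a′≢b′ = ⊥-elim (a′≢b′ (to a≡b))
... | no a≢b  | yes a′≡b′ = ⊥-elim (a≢b (from a′≡b′))
... | no _    | no _     = refl

δ-translate : ∀ a b s → δ (a + s) b ≡ δ a (b - s)
δ-translate a b s = δ-resp-⇔ (λ eq → trans (sym (cancel a s)) (cong (_- s) eq))
                             (λ eq → trans (cong (_+ s) eq) (uncancel b s))
  where cancel : ∀ a s → a + s - s ≡ a
        cancel = solve-∀
        uncancel : ∀ b s → b - s + s ≡ b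
        uncancel = solve-∀

δ-neg : ∀ a b → δ (- a) (- b) ≡ δ a b
δ-neg a b = δ-resp-⇔ ℤₚ.neg-injective (cong (λ i → - i))

multiplicity : ℕ → ℤ → ℤ
multiplicity r x = ∑[ k < suc r ] δ (weight r k) x

multiplicity-nonneg : ∀ r x → + 0 ≤ multiplicity r x
multiplicity-nonneg r x = ∑<-nonneg (suc r) (λ k → δ (weight r k) x) (λ k → δ-nonneg (weight r k) x)

multiplicity-weight : ∀ {r k} → k ℕ.≤ r → + 1 ≤ multiplicity r (weight r k)
multiplicity-weight {r} {k} k≤r =
  subst (_≤ multiplicity r (weight r k)) (δ-refl (weight r k))
        (∑<-term (suc r) (λ j → δ (weight r j) (weight r k)) (λ j → δ-nonneg (weight r j) (weight r k)) (s≤s k≤r))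

weight-mirror : ∀ {r k} → k ℕ.≤ r → weight r (r ∸ k) ≡ - weight r k
weight-mirror {k = k} k≤r with ℕₚ.m≤n⇒∃[o]m+o≡n k≤r
... | j , refl rewrite ℕₚ.m+n∸m≡n k j = lemma (+ k) (+ j)
  where lemma : ∀ K J → J + J - (K + J) ≡ - (K + K - (K + J))
        lemma = solve-∀

multiplicity-neg : ∀ r x → multiplicity r (- x) ≡ multiplicity r x
multiplicity-neg r x = begin
    ∑[ k < suc r ] δ (weight r k) (- x)
  ≡⟨ ∑<-reverse (suc r) (λ k → δ (weight r k) (- x)) ⟩
    ∑[ k < suc r ] δ (weight r (r ∸ k)) (- x)
  ≡⟨ ∑<-cong (suc r) (λ k k<1+r → trans (cong (λ w → δ w (- x)) (weight-mirror (ℕₚ.≤-pred k<1+r)))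
                                         (δ-neg (weight r k) x)) ⟩
    ∑[ k < suc r ] δ (weight r k) x ∎
  where open ≡-Reasoning

multiplicity-step : ∀ r x → x ≤ + r → multiplicity r (x - + 2) ≤ multiplicity r x
multiplicity-step r x x≤r = begin
    multiplicity r (x - + 2)
  ≡⟨ ∑<-last r (λ k → δ (weight r k) (x - + 2)) ⟩
    (∑[ k < r ] δ (weight r k) (x - + 2)) + δ (weight r r) (x - + 2)
  ≡⟨ cong₂ _+_ (∑<-cong r (λ k _ → trans (sym (δ-translate (weight r k) x (+ 2))) (cong (λ w → δ w x) (shift (+ r) (+ k)))))
               (δ-≢ (λ eq → ℤₚ.<-irrefl (sym eq)
                              (ℤₚ.<-≤-trans (below x) (subst (x ≤_) (sym (weight-highest r)) x≤r)))) ⟩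
    (∑[ k < r ] δ (weight r (suc k)) x) + + 0
  ≡⟨ ℤₚ.+-identityʳ _ ⟩
    ∑[ k < r ] δ (weight r (suc k)) x
  ≤⟨ ℤₚ.i≤j+i _ (δ (weight r 0) x) {{ℤ.nonNegative (δ-nonneg (weight r 0) x)}} ⟩
    multiplicity r x ∎
  where
    open ℤₚ.≤-Reasoning
    shift : ∀ R K → K + K - R + + 2 ≡ (+ 1 + K) + (+ 1 + K) - R
    shift = solve-∀
    below : ∀ x → x - + 2 < x
    below x = <-by (x - + 2) x 1 (lemma x)
      where lemma : ∀ x → x ≡ x - + 2 + + 2
            lemma = solve-∀

multiplicity-outside : ∀ {r R} x → r ≼ R → (∀ j → j ℕ.≤ R → weight R j ≢ x) → multiplicity r x ≡ + 0
multiplicity-outside {r} x (gap h refl) missed =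
  trans (∑<-cong (suc r) (λ k k<1+r →
          δ-≢ (λ eq → missed (k ℕ.+ h) (ℕₚ.+-mono-≤ (ℕₚ.≤-pred k<1+r) (ℕₚ.m≤m+n h h)) (trans (lift k) eq))))
        (∑<-zero (suc r))
  where
    lift : ∀ k → weight (r ℕ.+ (h ℕ.+ h)) (k ℕ.+ h) ≡ weight r k
    lift k = lemma (+ r) (+ h) (+ k)
      where lemma : ∀ R H K → (K + H) + (K + H) - (R + (H + H)) ≡ K + K - R
            lemma = solve-∀

maxRadius+2·2ⁿ≡2·3ⁿ : ∀ n → maxRadius n ℕ.+ (2 ^ n ℕ.+ 2 ^ n) ≡ 3 ^ n ℕ.+ 3 ^ n
maxRadius+2·2ⁿ≡2·3ⁿ zero    = refl
maxRadius+2·2ⁿ≡2·3ⁿ (suc n) = begin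
    maxRadius (suc n) ℕ.+ (2 ^ suc n ℕ.+ 2 ^ suc n)
  ≡⟨ lemma₁ (maxRadius n) (2 ^ n) ⟩
    3 ℕ.* (maxRadius n ℕ.+ (2 ^ n ℕ.+ 2 ^ n))
  ≡⟨ cong (3 ℕ.*_) (maxRadius+2·2ⁿ≡2·3ⁿ n) ⟩
    3 ℕ.* (3 ^ n ℕ.+ 3 ^ n)
  ≡⟨ lemma₂ (3 ^ n) ⟩
    3 ^ suc n ℕ.+ 3 ^ suc n ∎
  where
    open ≡-Reasoning
    lemma₁ : ∀ R p → (R ℕ.+ R) ℕ.+ (R ℕ.+ 2 ℕ.* p) ℕ.+ (2 ℕ.* p ℕ.+ 2 ℕ.* p) ≡ 3 ℕ.* (R ℕ.+ (p ℕ.+ p))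
    lemma₁ = ℕ-Solver.solve-∀
    lemma₂ : ∀ q → 3 ℕ.* (q ℕ.+ q) ≡ 3 ℕ.* q ℕ.+ 3 ℕ.* q
    lemma₂ = ℕ-Solver.solve-∀

maxRadius≡r+r : ∀ n → maxRadius n ≡ r n ℕ.+ r n
maxRadius≡r+r n = ℕₚ.+-cancelʳ-≡ (2 ^ n ℕ.+ 2 ^ n) _ _ (begin
    maxRadius n ℕ.+ (2 ^ n ℕ.+ 2 ^ n)
  ≡⟨ maxRadius+2·2ⁿ≡2·3ⁿ n ⟩
    3 ^ n ℕ.+ 3 ^ n
  ≡⟨ cong (λ m → m ℕ.+ m) (sym (ℕₚ.m+[n∸m]≡n 2ⁿ≤3ⁿ)) ⟩
    (2 ^ n ℕ.+ r n) ℕ.+ (2 ^ n ℕ.+ r n)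
  ≡⟨ lemma (2 ^ n) (r n) ⟩
    r n ℕ.+ r n ℕ.+ (2 ^ n ℕ.+ 2 ^ n) ∎)
  where
    open ≡-Reasoning
    2ⁿ≤3ⁿ : 2 ^ n ℕ.≤ 3 ^ n
    2ⁿ≤3ⁿ = ℕₚ.^-monoˡ-≤ n (ℕₚ.n≤1+n 2)
    lemma : ∀ p d → (p ℕ.+ d) ℕ.+ (p ℕ.+ d) ≡ d ℕ.+ d ℕ.+ (p ℕ.+ p)
    lemma = ℕ-Solver.solve-∀

coeffℤ-map : {A : Set} (F G : A → ℤ) (xs : List A) (m : ℤ) →
             coeffℤ (map (λ x → F x , G x) xs) m ≡ ∑[ x ∈ xs ] [ ⌊ G x ℤ.≟ m ⌋ ] F x
coeffℤ-map F G []       m = refl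
coeffℤ-map F G (x ∷ xs) m = cong (_+_ ([ ⌊ G x ℤ.≟ m ⌋ ] F x)) (coeffℤ-map F G xs m)

coeffℕ-map : {A : Set} (F : A → ℤ) (G : A → ℕ) (xs : List A) (m : ℕ) →
             coeffℕ (map (λ x → F x , G x) xs) m ≡ ∑[ x ∈ xs ] [ ⌊ G x ℕ.≟ m ⌋ ] F x
coeffℕ-map F G []       m = refl
coeffℕ-map F G (x ∷ xs) m = cong (_+_ ([ ⌊ G x ℕ.≟ m ⌋ ] F x)) (coeffℕ-map F G xs m)

[b]x≡x*[b]1 : (b : Bool) (s : ℤ) → [ b ] s ≡ s * ([ b ] + 1)
[b]x≡x*[b]1 true  s = sym (ℤₚ.*-identityʳ s)
[b]x≡x*[b]1 false s = sym (ℤₚ.*-zeroʳ s)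

E≈sumPlus : ∀ n → E n ≈t sumPlus n
E≈sumPlus n m = begin
    coeffℤ (E n) m
  ≡⟨ coeffℤ-map sgnT val (RV n) m ⟩
    ∑[ t ∈ RV n ] [ ⌊ val t ℤ.≟ m ⌋ ] sgnT t
  ≡⟨ ∑-cong (RV n) (λ t → [b]x≡x*[b]1 ⌊ val t ℤ.≟ m ⌋ (sgnT t)) ⟩
    ∑[ t ∈ RV n ] sgnT t * δ (val t) m
  ≡⟨ RV-signed n (λ v → δ v m) ⟩
    ∑[ t ∈ RV⁺ n ] δ (val t) m
  ≡⟨ sym (coeffℤ-map (λ _ → + 1) val (RV⁺ n) m) ⟩
    coeffℤ (sumPlus n) m ∎
  where open ≡-Reasoning

L∘E≈sumPrime : ∀ n → L (E n) ≈h sumPrime n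
L∘E≈sumPrime n m = begin
    coeffℕ (L (E n)) m
  ≡⟨ cong (λ xs → coeffℕ xs m) (sym (map-∘ (RV n))) ⟩
    coeffℕ (map (λ t → sgnT t * sgn (val t + + 1) , ∣ val t + + 1 ∣ ∸ 1) (RV n)) m
  ≡⟨ coeffℕ-map (λ t → sgnT t * sgn (val t + + 1)) (λ t → ∣ val t + + 1 ∣ ∸ 1) (RV n) m ⟩
    ∑[ t ∈ RV n ] [ ⌊ (∣ val t + + 1 ∣ ∸ 1) ℕ.≟ m ⌋ ] (sgnT t * sgn (val t + + 1))
  ≡⟨ ∑-cong (RV n) (λ t → trans ([b]x≡x*[b]1 ⌊ (∣ val t + + 1 ∣ ∸ 1) ℕ.≟ m ⌋ (sgnT t * sgn (val t + + 1)))
                                (ℤₚ.*-assoc (sgnT t) (sgn (val t + + 1)) _)) ⟩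
    ∑[ t ∈ RV n ] sgnT t * evalL hₘ (val t)
  ≡⟨ RV-signed n (evalL hₘ) ⟩
    ∑[ t ∈ RV⁺ n ] evalL hₘ (val t)
  ≡⟨ ∑-evalL-RV⁺ n hₘ ⟩
    ∑[ t ∈ RV' n ] hₘ ∣ val t ∣
  ≡⟨ sym (coeffℕ-map (λ _ → + 1) (λ t → ∣ val t ∣) (RV' n) m) ⟩
    coeffℕ (sumPrime n) m ∎
  where
    open ≡-Reasoning
    hₘ : ℕ → ℤ
    hₘ k = [ ⌊ k ℕ.≟ m ⌋ ] + 1

module Coefficients (n : ℕ) where
  open StringDecomposition (stringDecomposition n)

  C : ℤ
  C = pow2 (suc n)

  R : ℕ
  R = maxRadius n

  c : ℤ → ℤ
  c = coeffℤ (E n)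

  c≡∑multiplicity : ∀ x → c x ≡ ∑[ s ∈ radii ] multiplicity s (x - C)
  c≡∑multiplicity x = begin
      coeffℤ (E n) x
    ≡⟨ E≈sumPlus n x ⟩
      coeffℤ (sumPlus n) x
    ≡⟨ coeffℤ-map (λ _ → + 1) val (RV⁺ n) x ⟩
      ∑[ t ∈ RV⁺ n ] δ (val t) x
    ≡⟨ ∑-cong (RV⁺ n) (λ t → trans (cong (λ v → δ v x) (val≡ind+2ⁿ⁺¹ n t)) (δ-translate (ind n t) x C)) ⟩
      statistic n (λ d _ → δ d (x - C))
    ≡⟨ decomposes (λ d _ → δ d (x - C)) ⟩
      ∑[ s ∈ radii ] multiplicity s (x - C) ∎
    where open ≡-Reasoning

  c-positive : ∀ k → pow2 n - + r n ≤ k → k ≤ pow2 n + + r n → + 0 < c (+ 2 * k)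
  c-positive k lo≤k k≤hi = ℤₚ.<-≤-trans (+<+ (s≤s z≤n)) (begin
      + 1
    ≤⟨ multiplicity-weight j≤R ⟩
      multiplicity R (weight R j)
    ≡⟨ cong (multiplicity R) weight≡ ⟩
      multiplicity R (+ 2 * k - C)
    ≤⟨ ∑-term (λ s → multiplicity s (+ 2 * k - C)) radii (λ s → multiplicity-nonneg s (+ 2 * k - C)) maxRadius∈ ⟩
      ∑[ s ∈ radii ] multiplicity s (+ 2 * k - C)
    ≡⟨ sym (c≡∑multiplicity (+ 2 * k)) ⟩
      c (+ 2 * k) ∎)
    where
      open ℤₚ.≤-Reasoning
      P Q : ℤ
      P = pow2 n
      Q = + r n
      j : ℕ
      j = ∣ k - (P - Q) ∣
      +j : + j ≡ k - (P - Q)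
      +j = ℤₚ.0≤i⇒+∣i∣≡i (ℤₚ.i≤j⇒0≤j-i lo≤k)
      +R : + R ≡ Q + Q
      +R = cong +_ (maxRadius≡r+r n)
      j≤R : j ℕ.≤ R
      j≤R = ℤₚ.drop‿+≤+ (subst₂ _≤_ (sym +j) (trans (width P Q) (sym +R)) (ℤₚ.+-monoˡ-≤ (- (P - Q)) k≤hi))
        where width : ∀ P Q → P + Q - (P - Q) ≡ Q + Q
              width = solve-∀
      weight≡ : weight R j ≡ + 2 * k - C
      weight≡ = trans (cong₂ (λ a b → a + a - b) +j +R) (lemma k P Q)
        where lemma : ∀ k P Q → k - (P - Q) + (k - (P - Q)) - (Q + Q) ≡ + 2 * k - (P + (P + + 0))
              lemma = solve-∀

  c-symmetric : ∀ (i : ℕ) → c (C - + 2 * + i) ≡ c (C + + 2 * + i)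
  c-symmetric i = begin
      c (C - + 2 * + i)
    ≡⟨ c≡∑multiplicity (C - + 2 * + i) ⟩
      ∑[ s ∈ radii ] multiplicity s (C - + 2 * + i - C)
    ≡⟨ ∑-cong radii (λ s → trans (cong (multiplicity s) (below C (+ 2 * + i))) (multiplicity-neg s (+ 2 * + i))) ⟩
      ∑[ s ∈ radii ] multiplicity s (+ 2 * + i)
    ≡⟨ ∑-cong radii (λ s → cong (multiplicity s) (above C (+ 2 * + i))) ⟩
      ∑[ s ∈ radii ] multiplicity s (C + + 2 * + i - C)
    ≡⟨ sym (c≡∑multiplicity (C + + 2 * + i)) ⟩
      c (C + + 2 * + i) ∎
    where
      open ≡-Reasoning
      below : ∀ C y → C - y - C ≡ - y
      below = solve-∀
      above : ∀ C y → y ≡ C + y - C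
      above = solve-∀

  c-unimodal : ∀ (i : ℕ) → c (C - + 2 * + i) ≥ c (C - + 2 * + i - + 2)
  c-unimodal i = subst₂ _≤_ (sym (c≡∑multiplicity _)) (sym (c≡∑multiplicity _)) (∑-mono-≤ radii (λ s →
    subst₂ _≤_ (cong (multiplicity s) (twoBelow C (+ 2 * + i))) (cong (multiplicity s) (below C (+ 2 * + i)))
           (multiplicity-step s (- (+ 2 * + i)) (ℤₚ.≤-trans (ℤₚ.neg-mono-≤ 0≤2i) (+≤+ z≤n)))))
    where
      below : ∀ C y → - y ≡ C - y - C
      below = solve-∀
      twoBelow : ∀ C y → - y - + 2 ≡ C - y - + 2 - C
      twoBelow = solve-∀
      0≤2i : + 0 ≤ + 2 * + i
      0≤2i = subst (+ 0 ≤_) (ℤₚ.pos-* 2 i) (+≤+ z≤n)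

  point : ℕ → ℤ
  point j = weight R j + C

  point-injective : ∀ {j j′} → point j ≡ point j′ → j ≡ j′
  point-injective {j} {j′} eq =
    weight-injective R (trans (sym (cancel (weight R j) C)) (trans (cong (_- C) eq) (cancel (weight R j′) C)))
    where cancel : ∀ a c → a + c - c ≡ a
          cancel = solve-∀

  ∑-sift : ∀ m → ∑[ j < suc R ] [ ⌊ point j ℤ.≟ m ⌋ ] c (point j) ≡ c m
  ∑-sift m with ℕₚ.anyUpTo? (λ j → point j ℤ.≟ m) (suc R)
  ... | yes (j₀ , j₀<1+R , point≡m) =
    trans (∑<-single (suc R) (λ j → [ ⌊ point j ℤ.≟ m ⌋ ] c (point j)) j₀<1+R (λ j _ j≢j₀ →
             if-≟-≢ (λ eq → j≢j₀ (point-injective (trans eq (sym point≡m))))))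
          (trans (if-≟-≡ point≡m) (cong c point≡m))
  ... | no missed =
    trans (trans (∑<-cong (suc R) {g = λ _ → + 0} (λ j j<1+R →
                   if-≟-≢ {point j} {m} {c (point j)} (λ eq → missed (j , j<1+R , eq))))
                 (∑<-zero (suc R)))
          (sym (trans (c≡∑multiplicity m)
                      (trans (∑-cong-All radii-≼ (λ s≼R → multiplicity-outside (m - C) s≼R
                               (λ j j≤R eq → missed (j , s≤s j≤R , trans (cong (_+ C) eq) (uncancel m C)))))
                             (∑-zero radii))))
    where uncancel : ∀ m C → m - C + C ≡ m
          uncancel = solve-∀

  E≈rangeSum : E n ≈t rangeSum n c
  E≈rangeSum m = sym (begin
      coeffℤ (rangeSum n c) m
    ≡⟨ coeffℤ-map (λ k → c (+ 2 * k)) (λ k → + 2 * k) (interval lo hi) m ⟩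
      ∑[ k ∈ interval lo hi ] term (+ 2 * k)
    ≡⟨ cong (∑ (λ k → term (+ 2 * k))) interval≡ ⟩
      ∑[ k ∈ map (λ j → lo + + j) (upTo (suc R)) ] term (+ 2 * k)
    ≡⟨ ∑-map (λ k → term (+ 2 * k)) (λ j → lo + + j) (upTo (suc R)) ⟩
      ∑[ j ∈ upTo (suc R) ] term (+ 2 * (lo + + j))
    ≡⟨ ∑-applyUpTo (λ j → term (+ 2 * (lo + + j))) (λ j → j) (suc R) ⟩
      ∑[ j < suc R ] term (+ 2 * (lo + + j))
    ≡⟨ ∑<-cong (suc R) (λ j _ → cong term (doubled j)) ⟩
      ∑[ j < suc R ] term (point j)
    ≡⟨ ∑-sift m ⟩
      c m ∎)
    where
      open ≡-Reasoning
      lo hi : ℤ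
      lo = pow2 n - + r n
      hi = pow2 n + + r n
      term : ℤ → ℤ
      term v = [ ⌊ v ℤ.≟ m ⌋ ] c v
      +R : + R ≡ + r n + + r n
      +R = cong +_ (maxRadius≡r+r n)
      interval≡ : interval lo hi ≡ map (λ j → lo + + j) (upTo (suc R))
      interval≡ = trans (if-true (ℤₚ.≤⇒≤ᵇ (≤-by lo hi (r n ℕ.+ r n) (lemma₁ (pow2 n) (+ r n)))))
                        (cong (λ d → map (λ j → lo + + j) (upTo (suc ∣ d ∣))) (trans (lemma₂ (pow2 n) (+ r n)) (sym +R)))
        where lemma₁ : ∀ P Q → P + Q ≡ P - Q + (Q + Q)
              lemma₁ = solve-∀
              lemma₂ : ∀ P Q → P + Q - (P - Q) ≡ Q + Q
              lemma₂ = solve-∀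
      doubled : ∀ j → + 2 * (lo + + j) ≡ point j
      doubled j = trans (lemma (pow2 n) (+ r n) (+ j)) (cong (λ s → + j + + j - s + C) (sym +R))
        where lemma : ∀ P Q J → + 2 * (P - Q + J) ≡ J + J - (Q + Q) + (P + (P + + 0))
              lemma = solve-∀

corollary5p4 : (n : ℕ) →
    (E n ≈t sumPlus n) ×
    Σ (ℤ → ℤ) (λ c →
      (E n ≈t rangeSum n c) ×
      (∀ k → pow2 n - + r n ≤ k → k ≤ pow2 n + + r n → + 0 < c (+ 2 * k)) ×
      (∀ (i : ℕ) → c (pow2 (suc n) - + 2 * + i) ≡ c (pow2 (suc n) + + 2 * + i)) ×
      (∀ (i : ℕ) → c (pow2 (suc n) - + 2 * + i) ≥ c (pow2 (suc n) - + 2 * + i - + 2))) ×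
    (L (E n) ≈h sumPrime n)
corollary5p4 n =
  E≈sumPlus n , (c , E≈rangeSum , c-positive , c-symmetric , c-unimodal) , L∘E≈sumPrime n
  where open Coefficients n
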